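{- Let $\mathbb{F}$ be the finite field with $q$ elements, $b\ge1$, let $\widetilde\tau$ be a $b$-ball flag juggling state, and let $W$ be an integer greater than the largest position of a number in $\widetilde\tau$. Then the fraction of $b\times W$ matrices $M$ over $\mathbb{F}$ with $\widetilde\sigma(M)=\widetilde\tau$ is $(1-q^{ -1})^b\, q^{ -\ell(\widetilde\tau)}$, independent of $W$.
   Context: A $b$-ball flag juggling state is a word indexed by positions $0,1,2,\dots$ in which each of the numbers $1,\dots,b$ occurs exactly once and all other positions carry the symbol $-$. Consider $b\times W$ matrices of rank $b$ over $\mathbb{F}$ under the action of the group generated by downward row operations (left multiplication by invertible lower triangular $b\times b$ matrices) and rightward column operations (right multiplication by upper triangular $W\times W$ matrices with $1$s on the diagonal). Each orbit contains a unique partial permutation matrix of rank $b$ (a $0/1$ matrix with exactly one $1$ in each row and at most one in each column). For such a partial permutation matrix $P$, $\widetilde\sigma(P)$ is the flag juggling state having the number $i$ in position $j$ whenever $P_{ij}=1$ and $-$ elsewhere; $\widetilde\sigma(M)$ is defined as $\widetilde\sigma(P)$ for the unique partial permutation matrix $P$ in the orbit of $M$. For a flag juggling state, $\ell(\widetilde\tau)$ is the number of pairs of positions $i<j$ such that the entry at $i$ is strictly greater than the entry at $j$, where $-$ is treated as $+\infty$ (so pairs of two $-$s are not counted); e.g. $\ell(-\,3\,-\,1\,2)=7$. -}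

module Defs where

open import Level using (Level; _⊔_)
open import Algebra.Bundles using (CommutativeRing)
open import Data.Nat using (ℕ; zero; suc; _<_; _<ᵇ_; _≡ᵇ_) renaming (_+_ to _+ℕ_)
open import Data.Fin using (Fin; toℕ) renaming (zero to fz; suc to fs)
open import Data.Maybe using (Maybe; just; nothing) renaming (map to mapMaybe)
open import Data.Bool using (Bool; true; false; if_then_else_)
open import Data.List using (List; length)
open import Data.List.Relation.Unary.Any using (Any)
open import Data.List.Relation.Unary.AllPairs using (AllPairs)
open import Data.Product using (Σ; _×_; ∃)
open import Relation.Nullary using (¬_)
open import Relation.Binary.PropositionalEquality using (_≡_)
open import Data.Unit.Polymorphic using (⊤)
open import Function using (_∘_; _⇔_)
open import Function.Definitions using (Injective)

private variable c ℓ : Level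

IsField : CommutativeRing c ℓ → Set (c ⊔ ℓ)
IsField R = ¬ (1# ≈ 0#) × (∀ x → ¬ (x ≈ 0#) → ∃ λ y → x * y ≈ 1#)
  where open CommutativeRing R

HasCount : ∀ {p} {A : Set c} (_≈_ : A → A → Set ℓ) → (A → Set p) → ℕ →
           Set (c ⊔ ℓ ⊔ p)
HasCount {A = A} _≈_ P n =
  Σ (List A) λ xs →
    AllPairs (λ x y → ¬ (x ≈ y)) xs ×
    (∀ x → P x ⇔ Any (x ≈_) xs) ×
    length xs ≡ n

HasSize : CommutativeRing c ℓ → ℕ → Set (c ⊔ ℓ)
HasSize {ℓ = ℓ} R q = HasCount _≈_ (λ _ → ⊤ {ℓ}) q
  where open CommutativeRing R

-- Such a state is determined by the
-- position of each number 1,…,b; we index the numbers by Fin b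
-- (i : Fin b stands for the number toℕ i + 1).  Distinct numbers sit at
-- distinct positions; all other positions carry the symbol −.

record FlagState (b : ℕ) : Set where
  constructor flagState
  field
    pos : Fin b → ℕ
    pos-injective : Injective _≡_ _≡_ pos
open FlagState public

-- The entry of the word at position p: just i (the number toℕ i + 1)
-- or nothing (the symbol −).
entryAt : ∀ {b} → (Fin b → ℕ) → ℕ → Maybe (Fin b)
entryAt {zero}  f p = nothing
entryAt {suc b} f p =
  if f fz ≡ᵇ p then just fz else mapMaybe fs (entryAt (f ∘ fs) p)

-- strict comparison of entries, with − treated as +∞
-- (two −'s are not compared as greater).
_>ᴱ_ : ∀ {b} → Maybe (Fin b) → Maybe (Fin b) → Bool
nothing >ᴱ nothing = false
nothing >ᴱ just _  = true
just _  >ᴱ nothing = false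
just x  >ᴱ just y  = toℕ y <ᵇ toℕ x

count : ℕ → (ℕ → Bool) → ℕ
count zero    f = 0
count (suc n) f = count n f +ℕ (if f n then 1 else 0)

sumUpTo : ℕ → (ℕ → ℕ) → ℕ
sumUpTo zero    f = 0
sumUpTo (suc n) f = sumUpTo n f +ℕ f n

invUpTo : ∀ {b} → FlagState b → ℕ → ℕ
invUpTo τ N = sumUpTo N λ j → count j λ i →
  entryAt (pos τ) i >ᴱ entryAt (pos τ) j

posBound : ∀ {b} → (Fin b → ℕ) → ℕ
posBound {zero}  f = 0
posBound {suc b} f = suc (f fz) +ℕ posBound (f ∘ fs)

-- ℓ(τ): pairs of positions i < j with entry i > entry j.  Pairs with
-- j ≥ posBound have entry j = −, so they never count; hence the
-- truncation at posBound is exact.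
lengthℓ : ∀ {b} → FlagState b → ℕ
lengthℓ τ = invUpTo τ (posBound (pos τ))

module Matrices (R : CommutativeRing c ℓ) where
  open CommutativeRing R

  Matrix : ℕ → ℕ → Set c
  Matrix m n = Fin m → Fin n → Carrier

  _≈ᴹ_ : ∀ {m n} → Matrix m n → Matrix m n → Set ℓ
  M ≈ᴹ N = ∀ i j → M i j ≈ N i j

  sumF : ∀ {k} → (Fin k → Carrier) → Carrier
  sumF {zero}  f = 0#
  sumF {suc k} f = f fz + sumF (f ∘ fs)

  _·_ : ∀ {m k n} → Matrix m k → Matrix k n → Matrix m n
  (A · B) i j = sumF λ t → A i t * B t j

  identity : ∀ {n} → Matrix n n
  identity i j = if toℕ i ≡ᵇ toℕ j then 1# else 0#

  Invertible : ∀ {n} → Matrix n n → Set (c ⊔ ℓ)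
  Invertible A = ∃ λ B → (A · B) ≈ᴹ identity × (B · A) ≈ᴹ identity

  -- invertible lower triangular (downward row operations)
  LowerInvertible : ∀ {n} → Matrix n n → Set (c ⊔ ℓ)
  LowerInvertible L = (∀ i j → toℕ i < toℕ j → L i j ≈ 0#) × Invertible L

  -- upper triangular with 1s on the diagonal (rightward column operations)
  UpperUnitriangular : ∀ {n} → Matrix n n → Set ℓ
  UpperUnitriangular U =
    (∀ i j → toℕ j < toℕ i → U i j ≈ 0#) × (∀ i → U i i ≈ 1#)

  permMatrix : ∀ {b} → FlagState b → (W : ℕ) → Matrix b W
  permMatrix τ W i j = if pos τ i ≡ᵇ toℕ j then 1# else 0#

  -- σ̃(M) = τ̃ : the (unique) partial permutation matrix in the orbit of
  -- M is the one of τ̃, i.e. M = L · P_τ̃ · U for an invertible lower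
  -- triangular L and an upper unitriangular U.
  SigmaIs : ∀ {b W} → Matrix b W → FlagState b → Set (c ⊔ ℓ)
  SigmaIs {b} {W} M τ = Σ (Matrix b b) λ L → Σ (Matrix W W) λ U →
    LowerInvertible L × UpperUnitriangular U ×
    M ≈ᴹ ((L · permMatrix τ W) · U)

module Submission where

-- Let p k be the position of ball k.  M lies in the orbit of τ̃ iff
-- M = L · V with L lower triangular with nonzero diagonal and V in echelon
-- form with pivots p: row k of V is 1 at p k, 0 before it and 0 at the
-- pivots of the earlier rows (Orbit.orbit⇔factorisation, via Gaussian
-- elimination of P_τ̃ · U).  The factorisation is unique (echelon-unique),
-- so by the product principle (count-product) the orbit has
-- (q-1)^b q^(b(b-1)/2) · q^(free entries of V) elements.  In row k the W
-- columns split into the unoccupied ones before p k (ball k's share of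
-- ℓ(τ̃)), the pivot, the free ones and the k earlier pivots; summing over
-- the rows gives b(b-1)/2 + #free + ℓ(τ̃) + b = b W (exponent-identity).

open import Defs
open import Algebra.Bundles using (CommutativeRing)
open import Data.Nat using (ℕ)

module PositionCounting where

  open import Data.Nat
  open import Data.Nat.Properties
  open import Data.Bool using (Bool; true; false; if_then_else_; not; _∧_; _∨_)
  open import Data.Bool.Properties using (∨-identityʳ; ∧-identityʳ)
  open import Data.Fin using (Fin; toℕ) renaming (zero to fz; suc to fs)
  open import Data.Fin.Properties using () renaming (suc-injective to fs-injective; 0≢1+n to fz≢fs)
  open import Data.Maybe using (Maybe; just; nothing; maybe) renaming (map to mapMaybe)
  open import Data.Vec.Functional using (foldr)
  open import Data.Sum using (inj₁; inj₂)
  open import Function using (_∘_)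
  open import Relation.Nullary using (¬_; contradiction)
  open import Relation.Nullary.Reflects using (Reflects; ofʸ; ofⁿ; fromEquivalence)
  open import Relation.Binary.PropositionalEquality
  open import Data.Nat.Tactic.RingSolver using (solve-∀)
  open import Algebra.Properties.CommutativeSemigroup +-commutativeSemigroup using (interchange)

  ≡ᵇ-reflects-≡ : ∀ m n → Reflects (m ≡ n) (m ≡ᵇ n)
  ≡ᵇ-reflects-≡ m n = fromEquivalence (≡ᵇ⇒≡ m n) (≡⇒≡ᵇ m n)

  ≡ᵇ-true : ∀ {m n} → m ≡ n → (m ≡ᵇ n) ≡ true
  ≡ᵇ-true {m} {n} eq with m ≡ᵇ n | ≡ᵇ-reflects-≡ m n
  ... | true  | _       = refl
  ... | false | ofⁿ m≢n = contradiction eq m≢n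

  ≡ᵇ-false : ∀ {m n} → m ≢ n → (m ≡ᵇ n) ≡ false
  ≡ᵇ-false {m} {n} m≢n with m ≡ᵇ n | ≡ᵇ-reflects-≡ m n
  ... | true  | ofʸ eq = contradiction eq m≢n
  ... | false | _      = refl

  ≡ᵇ-sound : ∀ {m n} → (m ≡ᵇ n) ≡ true → m ≡ n
  ≡ᵇ-sound {m} {n} e with m ≡ᵇ n | ≡ᵇ-reflects-≡ m n
  ... | true | ofʸ eq = eq

  <ᵇ-true : ∀ {m n} → m < n → (m <ᵇ n) ≡ true
  <ᵇ-true {m} {n} lt with m <ᵇ n | <ᵇ-reflects-< m n
  ... | true  | _       = refl
  ... | false | ofⁿ m≮n = contradiction lt m≮n

  <ᵇ-false : ∀ {m n} → ¬ m < n → (m <ᵇ n) ≡ false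
  <ᵇ-false {m} {n} m≮n with m <ᵇ n | <ᵇ-reflects-< m n
  ... | true  | ofʸ lt = contradiction lt m≮n
  ... | false | _      = refl

  𝟙 : Bool → ℕ
  𝟙 b = if b then 1 else 0

  count-cong : ∀ n {f g : ℕ → Bool} → (∀ x → x < n → f x ≡ g x) → count n f ≡ count n g
  count-cong zero    eq = refl
  count-cong (suc n) eq =
    cong₂ _+_ (count-cong n (λ x x<n → eq x (m<n⇒m<1+n x<n))) (cong 𝟙 (eq n ≤-refl))

  count-false : ∀ n {f : ℕ → Bool} → (∀ x → x < n → f x ≡ false) → count n f ≡ 0
  count-false zero    eq = refl
  count-false (suc n) eq =
    cong₂ _+_ (count-false n (λ x x<n → eq x (m<n⇒m<1+n x<n))) (cong 𝟙 (eq n ≤-refl))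

  count-+ : ∀ n {f g h : ℕ → Bool} → (∀ x → 𝟙 (f x) ≡ 𝟙 (g x) + 𝟙 (h x)) →
            count n f ≡ count n g + count n h
  count-+ zero    eq = refl
  count-+ (suc n) {f} {g} {h} eq = begin
    count n f + 𝟙 (f n)                                ≡⟨ cong₂ _+_ (count-+ n eq) (eq n) ⟩
    (count n g + count n h) + (𝟙 (g n) + 𝟙 (h n))      ≡⟨ interchange (count n g) (count n h) _ _ ⟩
    (count n g + 𝟙 (g n)) + (count n h + 𝟙 (h n))      ∎
    where open ≡-Reasoning

  count-true : ∀ n → count n (λ _ → true) ≡ n
  count-true zero    = refl
  count-true (suc n) = trans (cong (_+ 1) (count-true n)) (+-comm n 1)

  count-split : ∀ W p (f : ℕ → Bool) → p < W →
                count W f ≡ count p f + 𝟙 (f p) + count W (λ x → (p <ᵇ x) ∧ f x)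
  count-split (suc W) p f p<1+W with m≤n⇒m<n∨m≡n (≤-pred p<1+W)
  ... | inj₁ p<W = begin
    count W f + 𝟙 (f W)
      ≡⟨ cong (_+ 𝟙 (f W)) (count-split W p f p<W) ⟩
    count p f + 𝟙 (f p) + count W after + 𝟙 (f W)
      ≡⟨ +-assoc (count p f + 𝟙 (f p)) _ _ ⟩
    count p f + 𝟙 (f p) + (count W after + 𝟙 (f W))
      ≡⟨ cong (λ b → count p f + 𝟙 (f p) + (count W after + 𝟙 (b ∧ f W))) (<ᵇ-true p<W) ⟨
    count p f + 𝟙 (f p) + count (suc W) after
      ∎
    where
    open ≡-Reasoning
    after = λ x → (p <ᵇ x) ∧ f x
  ... | inj₂ refl = sym (trans (cong (count p f + 𝟙 (f p) +_) nothing-after) (+-identityʳ _))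
    where
    nothing-after : count (suc p) (λ x → (p <ᵇ x) ∧ f x) ≡ 0
    nothing-after = count-false (suc p) λ x x≤p → cong (_∧ f x) (<ᵇ-false (≤⇒≯ (≤-pred x≤p)))

  count-single : ∀ W p → p < W → count W (p ≡ᵇ_) ≡ 1
  count-single W p p<W = begin
    count W (p ≡ᵇ_)                                              ≡⟨ count-split W p (p ≡ᵇ_) p<W ⟩
    count p (p ≡ᵇ_) + 𝟙 (p ≡ᵇ p) + count W (λ x → (p <ᵇ x) ∧ (p ≡ᵇ x))
      ≡⟨ cong₃ (λ a b c → a + b + c)
               (count-false p (λ x x<p → ≡ᵇ-false (>⇒≢ x<p)))
               (cong 𝟙 (≡ᵇ-true {p} refl))
               (count-false W λ x _ → after x) ⟩
    0 + 1 + 0                                                    ∎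
    where
    open ≡-Reasoning
    cong₃ : ∀ (f : ℕ → ℕ → ℕ → ℕ) {a a' b b' c c'} → a ≡ a' → b ≡ b' → c ≡ c' → f a b c ≡ f a' b' c'
    cong₃ f refl refl refl = refl
    after : ∀ x → ((p <ᵇ x) ∧ (p ≡ᵇ x)) ≡ false
    after x with p <ᵇ x | <ᵇ-reflects-< p x
    ... | false | _      = refl
    ... | true  | ofʸ lt = ≡ᵇ-false (<⇒≢ lt)

  -- Sets of occupied positions are Boolean predicates on ℕ.
  ∅ : ℕ → Bool
  ∅ _ = false

  _∪[_] : (ℕ → Bool) → ℕ → ℕ → Bool
  (Z ∪[ p ]) x = Z x ∨ (p ≡ᵇ x)

  count-insert : ∀ W p (Z : ℕ → Bool) → p < W → Z p ≡ false → count W (Z ∪[ p ]) ≡ count W Z + 1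
  count-insert W p Z p<W Zp≡false =
    trans (count-+ W indicator) (cong (count W Z +_) (count-single W p p<W))
    where
    indicator : ∀ x → 𝟙 ((Z ∪[ p ]) x) ≡ 𝟙 (Z x) + 𝟙 (p ≡ᵇ x)
    indicator x with p ≡ᵇ x | ≡ᵇ-reflects-≡ p x
    ... | true  | ofʸ refl rewrite Zp≡false = refl
    ... | false | _ rewrite ∨-identityʳ (Z x) = sym (+-identityʳ _)

  ∪-unoccupied : ∀ {Z : ℕ → Bool} {p x} → Z x ≡ false → p ≢ x → (Z ∪[ p ]) x ≡ false
  ∪-unoccupied {Z} {p} {x} Zx≡false p≢x rewrite Zx≡false = ≡ᵇ-false p≢x

  -- A column x of an echelon row with pivot p is free (an arbitrary entry)
  -- when it lies right of the pivot and outside the occupied set Z.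
  free : ℕ → (ℕ → Bool) → ℕ → Bool
  free p Z x = (p <ᵇ x) ∧ not (Z x)

  row-identity : ∀ W p (Z : ℕ → Bool) → p < W → Z p ≡ false →
                 count p (not ∘ Z) + 1 + count W (free p Z) + count W Z ≡ W
  row-identity W p Z p<W Zp≡false = begin
    count p (not ∘ Z) + 1 + count W (free p Z) + count W Z
      ≡⟨ cong (λ b → count p (not ∘ Z) + 𝟙 (not b) + count W (free p Z) + count W Z) Zp≡false ⟨
    count p (not ∘ Z) + 𝟙 (not (Z p)) + count W (free p Z) + count W Z
      ≡⟨ cong (_+ count W Z) (count-split W p (not ∘ Z) p<W) ⟨
    count W (not ∘ Z) + count W Z
      ≡⟨ count-+ W (λ x → complement (Z x)) ⟨
    count W (λ _ → true)
      ≡⟨ count-true W ⟩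
    W ∎
    where
    open ≡-Reasoning
    complement : ∀ b → 𝟙 true ≡ 𝟙 (not b) + 𝟙 b
    complement true  = refl
    complement false = refl

  -- Σ over the balls k of g (p k) (Z ∪ {p 0 , … , p (k-1)}): ball k sees the
  -- positions of the earlier balls as occupied.
  sumBalls : (ℕ → (ℕ → Bool) → ℕ) → ∀ {n} → (Fin n → ℕ) → (ℕ → Bool) → ℕ
  sumBalls g {zero}  p Z = 0
  sumBalls g {suc n} p Z = g (p fz) Z + sumBalls g (p ∘ fs) (Z ∪[ p fz ])

  gaps : ∀ {n} → (Fin n → ℕ) → (ℕ → Bool) → ℕ
  gaps = sumBalls λ p Z → count p (not ∘ Z)

  freeCells : ℕ → ∀ {n} → (Fin n → ℕ) → (ℕ → Bool) → ℕ
  freeCells W = sumBalls λ p Z → count W (free p Z)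

  -- triangle n = 0 + 1 + … + (n - 1), the number of entries strictly below
  -- the diagonal of an n × n matrix.
  triangle : ℕ → ℕ
  triangle zero    = 0
  triangle (suc n) = n + triangle n

  dimension-identity : ∀ W {n} (p : Fin n → ℕ) (Z : ℕ → Bool) → (∀ {i j} → p i ≡ p j → i ≡ j) →
    (∀ k → p k < W) → (∀ k → Z (p k) ≡ false) →
    gaps p Z + n + freeCells W p Z + (n * count W Z + triangle n) ≡ n * W
  dimension-identity W {zero}  p Z p-inj p<W unoccupied = refl
  dimension-identity W {suc n} p Z p-inj p<W unoccupied = begin
    (g₀ + g′) + suc n + (f₀ + f′) + (suc n * z + (n + triangle n))
      ≡⟨ regroup g₀ g′ f₀ f′ n z (triangle n) ⟩
    (g₀ + 1 + f₀ + z) + (g′ + n + f′ + (n * (z + 1) + triangle n))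
      ≡⟨ cong₂ _+_ (row-identity W (p fz) Z (p<W fz) (unoccupied fz)) rest ⟩
    W + n * W ∎
    where
    open ≡-Reasoning
    Z′ = Z ∪[ p fz ]
    g₀ = count (p fz) (not ∘ Z)
    f₀ = count W (free (p fz) Z)
    z  = count W Z
    g′ = gaps (p ∘ fs) Z′
    f′ = freeCells W (p ∘ fs) Z′
    regroup : ∀ g₀ g′ f₀ f′ n z t → (g₀ + g′) + suc n + (f₀ + f′) + (suc n * z + (n + t))
                                   ≡ (g₀ + 1 + f₀ + z) + (g′ + n + f′ + (n * (z + 1) + t))
    regroup = solve-∀
    unoccupied′ : ∀ k → Z′ (p (fs k)) ≡ false
    unoccupied′ k = ∪-unoccupied {Z} (unoccupied (fs k)) (fz≢fs ∘ p-inj)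
    rest : g′ + n + f′ + (n * (z + 1) + triangle n) ≡ n * W
    rest = begin
      g′ + n + f′ + (n * (z + 1) + triangle n)
        ≡⟨ cong (λ c → g′ + n + f′ + (n * c + triangle n)) (count-insert W (p fz) Z (p<W fz) (unoccupied fz)) ⟨
      g′ + n + f′ + (n * count W Z′ + triangle n)
        ≡⟨ dimension-identity W (p ∘ fs) Z′ (fs-injective ∘ p-inj) (p<W ∘ fs) unoccupied′ ⟩
      n * W ∎

  sumFin : ∀ {n} → (Fin n → ℕ) → ℕ
  sumFin = foldr _+_ 0

  sumUpTo-cong : ∀ N {f g : ℕ → ℕ} → (∀ x → x < N → f x ≡ g x) → sumUpTo N f ≡ sumUpTo N g
  sumUpTo-cong zero    eq = refl
  sumUpTo-cong (suc N) eq = cong₂ _+_ (sumUpTo-cong N (λ x x<N → eq x (m<n⇒m<1+n x<N))) (eq N ≤-refl)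

  sumUpTo-zero : ∀ N {f : ℕ → ℕ} → (∀ x → x < N → f x ≡ 0) → sumUpTo N f ≡ 0
  sumUpTo-zero zero    eq = refl
  sumUpTo-zero (suc N) eq = cong₂ _+_ (sumUpTo-zero N (λ x x<N → eq x (m<n⇒m<1+n x<N))) (eq N ≤-refl)

  sumUpTo-+ : ∀ N (f g : ℕ → ℕ) → sumUpTo N (λ x → f x + g x) ≡ sumUpTo N f + sumUpTo N g
  sumUpTo-+ zero    f g = refl
  sumUpTo-+ (suc N) f g =
    trans (cong (_+ (f N + g N)) (sumUpTo-+ N f g)) (interchange (sumUpTo N f) (sumUpTo N g) (f N) (g N))

  sumUpTo-single : ∀ N p a → p < N → sumUpTo N (λ j → if p ≡ᵇ j then a else 0) ≡ a
  sumUpTo-single (suc N) p a p<1+N with m≤n⇒m<n∨m≡n (≤-pred p<1+N)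
  ... | inj₁ p<N =
    trans (cong₂ _+_ (sumUpTo-single N p a p<N) (cong (if_then a else 0) (≡ᵇ-false (<⇒≢ p<N))))
          (+-identityʳ a)
  ... | inj₂ refl =
    cong₂ _+_ (sumUpTo-zero p (λ x x<p → cong (if_then a else 0) (≡ᵇ-false (>⇒≢ x<p))))
              (cong (if_then a else 0) (≡ᵇ-true {p} refl))

  entryAt-sound : ∀ {b} (f : Fin b → ℕ) x k → entryAt f x ≡ just k → f k ≡ x
  entryAt-sound {suc b} f x k eq with f fz ≡ᵇ x | ≡ᵇ-reflects-≡ (f fz) x
  entryAt-sound {suc b} f x fz refl | true | ofʸ f₀≡x = f₀≡x
  ... | false | _ with entryAt (f ∘ fs) x in eq′
  entryAt-sound {suc b} f x (fs k) refl | false | _ | just k = entryAt-sound (f ∘ fs) x k eq′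

  entryAt-pos : ∀ {b} (f : Fin b → ℕ) → (∀ {i j} → f i ≡ f j → i ≡ j) → ∀ k → entryAt f (f k) ≡ just k
  entryAt-pos {suc b} f f-inj fz rewrite ≡ᵇ-true {f fz} refl = refl
  entryAt-pos {suc b} f f-inj (fs k) rewrite ≡ᵇ-false {f fz} {f (fs k)} (fz≢fs ∘ f-inj)
                                    | entryAt-pos (f ∘ fs) (fs-injective ∘ f-inj) k = refl

  sumUpTo-entryAt : ∀ {b} (p : Fin b → ℕ) → (∀ {i j} → p i ≡ p j → i ≡ j) → ∀ N → (∀ k → p k < N) →
                    (g : Fin b → ℕ) → sumUpTo N (λ j → maybe g 0 (entryAt p j)) ≡ sumFin g
  sumUpTo-entryAt {zero}  p p-inj N p<N g = sumUpTo-zero N (λ _ _ → refl)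
  sumUpTo-entryAt {suc b} p p-inj N p<N g = begin
    sumUpTo N (λ j → maybe g 0 (entryAt p j))
      ≡⟨ sumUpTo-cong N (λ j _ → split j) ⟩
    sumUpTo N (λ j → (if p fz ≡ᵇ j then g fz else 0) + maybe (g ∘ fs) 0 (entryAt (p ∘ fs) j))
      ≡⟨ sumUpTo-+ N _ _ ⟩
    sumUpTo N (λ j → if p fz ≡ᵇ j then g fz else 0) + sumUpTo N (λ j → maybe (g ∘ fs) 0 (entryAt (p ∘ fs) j))
      ≡⟨ cong₂ _+_ (sumUpTo-single N (p fz) (g fz) (p<N fz))
                   (sumUpTo-entryAt (p ∘ fs) (fs-injective ∘ p-inj) N (p<N ∘ fs) (g ∘ fs)) ⟩
    g fz + sumFin (g ∘ fs) ∎
    where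
    open ≡-Reasoning
    maybe-fs : ∀ (e : Maybe (Fin b)) → maybe g 0 (mapMaybe fs e) ≡ maybe (g ∘ fs) 0 e
    maybe-fs (just k) = refl
    maybe-fs nothing  = refl
    split : ∀ j → maybe g 0 (entryAt p j) ≡ (if p fz ≡ᵇ j then g fz else 0) + maybe (g ∘ fs) 0 (entryAt (p ∘ fs) j)
    split j with p fz ≡ᵇ j | ≡ᵇ-reflects-≡ (p fz) j
    ... | false | _ = maybe-fs (entryAt (p ∘ fs) j)
    ... | true | ofʸ p₀≡j with entryAt (p ∘ fs) j in eq
    ...   | nothing = sym (+-identityʳ _)
    ...   | just k  = contradiction (p-inj (trans p₀≡j (sym (entryAt-sound (p ∘ fs) j k eq)))) fz≢fs

  -- Before ball k, a position carries a larger entry (a later ball or −)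
  -- exactly when no earlier ball sits there.
  larger-before-balls : ∀ {n} (p : Fin n → ℕ) (Z : ℕ → Bool) →
    sumFin (λ k → count (p k) (λ i → not (Z i) ∧ (entryAt p i >ᴱ just k))) ≡ gaps p Z
  larger-before-balls {zero}  p Z = refl
  larger-before-balls {suc n} p Z =
    cong₂ _+_ (count-cong (p fz) first)
              (trans (sumFin-cong (λ k → count-cong (p (fs k)) (λ i _ → later k i)))
                     (larger-before-balls (p ∘ fs) (Z ∪[ p fz ])))
    where
    sumFin-cong : ∀ {m} {f g : Fin m → ℕ} → (∀ k → f k ≡ g k) → sumFin f ≡ sumFin g
    sumFin-cong {zero}  eq = refl
    sumFin-cong {suc m} eq = cong₂ _+_ (eq fz) (sumFin-cong (eq ∘ fs))
    above-first : ∀ (e : Maybe (Fin n)) → (mapMaybe fs e >ᴱ just fz) ≡ true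
    above-first (just _) = refl
    above-first nothing  = refl
    first : ∀ i → i < p fz → (not (Z i) ∧ (entryAt p i >ᴱ just fz)) ≡ not (Z i)
    first i i<p₀ rewrite ≡ᵇ-false (>⇒≢ i<p₀) | above-first (entryAt (p ∘ fs) i) = ∧-identityʳ _
    later : ∀ k i → (not (Z i) ∧ (entryAt p i >ᴱ just (fs k)))
                  ≡ (not ((Z ∪[ p fz ]) i) ∧ (entryAt (p ∘ fs) i >ᴱ just k))
    later k i with p fz ≡ᵇ i | Z i | entryAt (p ∘ fs) i
    ... | true  | true  | _       = refl
    ... | true  | false | _       = refl
    ... | false | true  | _       = refl
    ... | false | false | just _  = refl
    ... | false | false | nothing = refl

  length-as-gaps : ∀ {b} (τ : FlagState b) → lengthℓ τ ≡ gaps (pos τ) ∅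
  length-as-gaps τ = begin
    sumUpTo N (λ j → count j (λ i → e i >ᴱ e j))
      ≡⟨ sumUpTo-cong N (λ j _ → by-entry j) ⟩
    sumUpTo N (λ j → maybe inv 0 (e j))
      ≡⟨ sumUpTo-entryAt (pos τ) (pos-injective τ) N (below-posBound (pos τ)) inv ⟩
    sumFin inv
      ≡⟨ larger-before-balls (pos τ) ∅ ⟩
    gaps (pos τ) ∅ ∎
    where
    open ≡-Reasoning
    N = posBound (pos τ)
    e = entryAt (pos τ)
    inv = λ k → count (pos τ k) (λ i → e i >ᴱ just k)
    below-posBound : ∀ {b} (f : Fin b → ℕ) k → f k < posBound f
    below-posBound f fz     = m≤m+n (suc (f fz)) _
    below-posBound f (fs k) = <-≤-trans (below-posBound (f ∘ fs) k) (m≤n+m _ (suc (f fz)))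
    not-above-blank : ∀ (x : Maybe _) → (x >ᴱ nothing) ≡ false
    not-above-blank (just _) = refl
    not-above-blank nothing  = refl
    by-entry : ∀ j → count j (λ i → e i >ᴱ e j) ≡ maybe inv 0 (e j)
    by-entry j with e j in eq
    ... | nothing = count-false j (λ i _ → not-above-blank (e i))
    ... | just k rewrite entryAt-sound (pos τ) j k eq = refl

  collect-powers : ∀ x q t f l b → x * q ^ t * q ^ f * q ^ l * q ^ b ≡ x * q ^ (t + f + l + b)
  collect-powers x q t f l b = begin
    x * q ^ t * q ^ f * q ^ l * q ^ b    ≡⟨ reassociate x (q ^ t) (q ^ f) (q ^ l) (q ^ b) ⟩
    x * (q ^ t * q ^ f * q ^ l * q ^ b)  ≡⟨ cong (x *_) split-exponent ⟨
    x * q ^ (t + f + l + b)              ∎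
    where
    open ≡-Reasoning
    reassociate : ∀ x a b c d → x * a * b * c * d ≡ x * (a * b * c * d)
    reassociate = solve-∀
    split-exponent : q ^ (t + f + l + b) ≡ q ^ t * q ^ f * q ^ l * q ^ b
    split-exponent = trans (^-distribˡ-+-* q (t + f + l) b) (cong (_* q ^ b)
                       (trans (^-distribˡ-+-* q (t + f) l) (cong (_* q ^ l) (^-distribˡ-+-* q t f))))

  prodFin : ∀ {n} → (Fin n → ℕ) → ℕ
  prodFin = foldr _*_ 1

  count-shift : ∀ n (f : ℕ → Bool) → count (suc n) f ≡ 𝟙 (f 0) + count n (f ∘ suc)
  count-shift zero    f = sym (+-identityʳ _)
  count-shift (suc n) f =
    trans (cong (_+ 𝟙 (f (suc n))) (count-shift n f)) (+-assoc (𝟙 (f 0)) _ _)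

  prodFin-pow : ∀ q W (B : ℕ → Bool) → prodFin {W} (λ c → if B (toℕ c) then q else 1) ≡ q ^ count W B
  prodFin-pow q zero    B = refl
  prodFin-pow q (suc W) B = begin
    (if B 0 then q else 1) * prodFin {W} (λ c → if B (suc (toℕ c)) then q else 1)
      ≡⟨ cong ((if B 0 then q else 1) *_) (prodFin-pow q W (B ∘ suc)) ⟩
    (if B 0 then q else 1) * q ^ count W (B ∘ suc)
      ≡⟨ first-factor (B 0) ⟩
    q ^ (𝟙 (B 0) + count W (B ∘ suc))
      ≡⟨ cong (q ^_) (count-shift W B) ⟨
    q ^ count (suc W) B ∎
    where
    open ≡-Reasoning
    first-factor : ∀ b → (if b then q else 1) * q ^ count W (B ∘ suc) ≡ q ^ (𝟙 b + count W (B ∘ suc))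
    first-factor true  = refl
    first-factor false = +-identityʳ _

  exponent-identity : ∀ {b} (τ : FlagState b) W → (∀ k → pos τ k < W) →
    triangle b + freeCells W (pos τ) ∅ + lengthℓ τ + b ≡ b * W
  exponent-identity {b} τ W p<W = begin
    triangle b + F + lengthℓ τ + b         ≡⟨ cong (λ l → triangle b + F + l + b) (length-as-gaps τ) ⟩
    triangle b + F + G + b                 ≡⟨ regroup (triangle b) F G b ⟩
    G + b + F + (b * 0 + triangle b)       ≡⟨ cong (λ z → G + b + F + (b * z + triangle b)) nothing-occupied ⟨
    G + b + F + (b * count W ∅ + triangle b) ≡⟨ dimension-identity W (pos τ) ∅ (pos-injective τ) p<W (λ _ → refl) ⟩
    b * W                                  ∎
    where
    open ≡-Reasoning
    F = freeCells W (pos τ) ∅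
    G = gaps (pos τ) ∅
    nothing-occupied : count W ∅ ≡ 0
    nothing-occupied = count-false W (λ _ _ → refl)
    regroup : ∀ t f g b → t + f + g + b ≡ g + b + f + (b * 0 + t)
    regroup = solve-∀

module Enumeration where

  open import Data.Nat using (ℕ; zero; suc; _*_; _∸_; _+_; pred)
  open import Data.Fin using (Fin) renaming (zero to fz; suc to fs)
  open import Data.List using (List; []; _∷_; [_]; length; map; cartesianProductWith; removeAt)
  open import Data.List.Properties using (length-++; length-map; length-removeAt)
  open import Data.List.Relation.Unary.Any using (Any; here; there; index)
  open import Data.List.Relation.Unary.All as All using (All; []; _∷_)
  import Data.List.Relation.Unary.All.Properties as All
  open import Data.List.Relation.Unary.All.Properties using (All¬⇒¬Any)
  open import Data.List.Relation.Unary.AllPairs as AllPairs using (AllPairs; []; _∷_)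
  import Data.List.Relation.Unary.AllPairs.Properties as AllPairs
  import Data.List.Membership.Setoid.Properties as Membership
  open import Data.Product using (∃₂; _×_; _,_; proj₁; proj₂)
  open import Data.Vec.Functional using (Vector; head; tail) renaming (_∷_ to _◂_)
  import Data.Vec.Functional.Relation.Binary.Equality.Setoid as VecEquality
  open import Data.Empty using (⊥-elim)
  open import Function using (_⇔_; mk⇔; Equivalence; _∘_)
  open import Level using (Level)
  open import Relation.Nullary using (¬_)
  open import Relation.Binary.Bundles using (Setoid)
  open import Relation.Binary.Core using (_Preserves₂_⟶_⟶_)
  open import Relation.Binary.PropositionalEquality as ≡ using (_≡_; cong₂)
  open PositionCounting using (prodFin)

  open Equivalence using (to; from)

  private variable
    a ℓ₁ ℓ₂ ℓ₃ p q r : Level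

  length-cartesianProductWith : ∀ {A B C : Set a} (f : A → B → C) xs ys →
    length (cartesianProductWith f xs ys) ≡ length xs * length ys
  length-cartesianProductWith f []       ys = ≡.refl
  length-cartesianProductWith f (x ∷ xs) ys = ≡.trans (length-++ (map (f x) ys))
    (cong₂ _+_ (length-map (f x) ys) (length-cartesianProductWith f xs ys))

  module _ (S : Setoid a ℓ₁) where
    open Setoid S renaming (Carrier to A)

    counted-members : ∀ {P : A → Set p} {n} (count : HasCount _≈_ P n) → All P (proj₁ count)
    counted-members (xs , _ , P⇔ , _) = All.tabulateₛ S (λ {x} x∈ → from (P⇔ x) x∈)

    counted-resp : ∀ {P : A → Set p} {n} → HasCount _≈_ P n → ∀ {x y} → x ≈ y → P x → P y
    counted-resp (xs , _ , P⇔ , _) x≈y Px = from (P⇔ _) (Membership.∈-resp-≈ S x≈y (to (P⇔ _) Px))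

    counted-cong : ∀ {P Q : A → Set p} {n} → (∀ x → P x ⇔ Q x) → HasCount _≈_ P n → HasCount _≈_ Q n
    counted-cong P⇔Q (xs , xs! , P⇔ , len) =
      xs , xs! , (λ x → mk⇔ (to (P⇔ x) ∘ from (P⇔Q x)) (to (P⇔Q x) ∘ from (P⇔ x))) , len

    count-singleton : ∀ (a : A) → HasCount _≈_ (_≈ a) 1
    count-singleton a = [ a ] , [] ∷ [] , (λ x → mk⇔ here (λ { (here x≈a) → x≈a ; (there ()) })) , ≡.refl

    all-removeAt : ∀ {R : A → Set p} {z ys} (z∈ : Any (z ≈_) ys) → All R ys → All R (removeAt ys (index z∈))
    all-removeAt (here _)   (_ ∷ rs) = rs
    all-removeAt (there z∈) (r ∷ rs) = r ∷ all-removeAt z∈ rs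

    unique-removeAt : ∀ {z ys} (z∈ : Any (z ≈_) ys) → AllPairs (λ u v → ¬ u ≈ v) ys →
                      AllPairs (λ u v → ¬ u ≈ v) (removeAt ys (index z∈))
    unique-removeAt (here _)   (_ ∷ ys!)    = ys!
    unique-removeAt (there z∈) (y∉ys ∷ ys!) = all-removeAt z∈ y∉ys ∷ unique-removeAt z∈ ys!

    removeAt-⊆ : ∀ {z ys x} (z∈ : Any (z ≈_) ys) → Any (x ≈_) (removeAt ys (index z∈)) → Any (x ≈_) ys
    removeAt-⊆ (here _)   x∈         = there x∈
    removeAt-⊆ (there z∈) (here x≈y) = here x≈y
    removeAt-⊆ (there z∈) (there x∈) = there (removeAt-⊆ z∈ x∈)

    removeAt-∉ : ∀ {z ys x} (z∈ : Any (z ≈_) ys) → AllPairs (λ u v → ¬ u ≈ v) ys →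
                 Any (x ≈_) (removeAt ys (index z∈)) → ¬ x ≈ z
    removeAt-∉ (here z≈y) (y∉ys ∷ _) x∈ x≈z = All¬⇒¬Any y∉ys (Membership.∈-resp-≈ S (trans x≈z z≈y) x∈)
    removeAt-∉ (there z∈) (y∉ys ∷ _) (here x≈y) x≈z =
      All¬⇒¬Any y∉ys (Membership.∈-resp-≈ S (trans (sym x≈z) x≈y) z∈)
    removeAt-∉ (there z∈) (_ ∷ ys!) (there x∈) = removeAt-∉ z∈ ys! x∈

    ∈-removeAt : ∀ {z ys x} (z∈ : Any (z ≈_) ys) → Any (x ≈_) ys → ¬ x ≈ z → Any (x ≈_) (removeAt ys (index z∈))
    ∈-removeAt (here z≈y) (here x≈y) x≉z = ⊥-elim (x≉z (trans x≈y (sym z≈y)))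
    ∈-removeAt (here _)   (there x∈) _   = x∈
    ∈-removeAt (there _)  (here x≈y) _   = here x≈y
    ∈-removeAt (there z∈) (there x∈) x≉z = there (∈-removeAt z∈ x∈ x≉z)

    count-remove : ∀ {P : A → Set p} {n} {z} → HasCount _≈_ P n → P z →
                   HasCount _≈_ (λ x → P x × ¬ x ≈ z) (n ∸ 1)
    count-remove {P = P} {z = z} (xs , xs! , P⇔ , ≡.refl) Pz =
      removeAt xs (index z∈xs) , unique-removeAt z∈xs xs! ,
      (λ x → mk⇔ (λ (Px , x≉z) → ∈-removeAt z∈xs (to (P⇔ x) Px) x≉z)
                 (λ x∈ → from (P⇔ x) (removeAt-⊆ z∈xs x∈) , removeAt-∉ z∈xs xs! x∈)) ,
      ≡.trans (length-removeAt xs (index z∈xs)) (pred≡∸1 (length xs))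
      where
      z∈xs = to (P⇔ z) Pz
      pred≡∸1 : ∀ n → pred n ≡ n ∸ 1
      pred≡∸1 zero    = ≡.refl
      pred≡∸1 (suc n) = ≡.refl

  restrict-allPairs : ∀ {A : Set a} {Q : A → Set q} {R : A → A → Set r} {xs} →
    All Q xs → AllPairs (λ x y → Q x → Q y → R x y) xs → AllPairs R xs
  restrict-allPairs []         []         = []
  restrict-allPairs (qx ∷ qxs) (h ∷ hs) =
    All.zipWith (λ (g , qy) → g qx qy) (h , qxs) ∷ restrict-allPairs qxs hs

  all-cartesianProductWith : ∀ {A B C : Set a} {P : A → Set p} {Q : B → Set q} {R : C → Set r}
    (f : A → B → C) {xs ys} → All P xs → All Q ys → (∀ {x y} → P x → Q y → R (f x y)) →
    All R (cartesianProductWith f xs ys)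
  all-cartesianProductWith f {xs} {ys} pxs qys pres =
    All.cartesianProductWith⁺ (≡.setoid _) (≡.setoid _) f xs ys
      (λ x∈ y∈ → pres (All.lookup pxs x∈) (All.lookup qys y∈))

  module _ (S₁ : Setoid a ℓ₁) (S₂ : Setoid a ℓ₂) (S₃ : Setoid a ℓ₃) where
    open Setoid S₁ using () renaming (Carrier to A; _≈_ to _≈₁_)
    open Setoid S₂ using () renaming (Carrier to B; _≈_ to _≈₂_)
    open Setoid S₃ using () renaming (Carrier to C; _≈_ to _≈₃_; sym to sym₃)

    InjectiveOn : (P : A → Set p) (Q : B → Set q) → (A → B → C) → Set _
    InjectiveOn P Q f = ∀ {x x′ y y′} → P x → P x′ → Q y → Q y′ → f x y ≈₃ f x′ y′ → x ≈₁ x′ × y ≈₂ y′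

    unique-cartesianProductWith : ∀ {P : A → Set p} {Q : B → Set q} (f : A → B → C) → InjectiveOn P Q f →
      ∀ {xs ys} → All P xs → All Q ys →
      AllPairs (λ u v → ¬ u ≈₁ v) xs → AllPairs (λ u v → ¬ u ≈₂ v) ys →
      AllPairs (λ u v → ¬ u ≈₃ v) (cartesianProductWith f xs ys)
    unique-cartesianProductWith f inj []         qys []           ys! = []
    unique-cartesianProductWith f inj {x ∷ xs} {ys} (px ∷ pxs) qys (x∉xs ∷ xs!) ys! =
      AllPairs.++⁺ row (unique-cartesianProductWith f inj pxs qys xs! ys!) row#rest
      where
      row : AllPairs (λ u v → ¬ u ≈₃ v) (map (f x) ys)
      row = AllPairs.map⁺ (restrict-allPairs qys
              (AllPairs.map (λ y≉y′ qy qy′ eq → y≉y′ (proj₂ (inj px px qy qy′ eq))) ys!))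
      row#rest : All (λ u → All (λ v → ¬ u ≈₃ v) (cartesianProductWith f xs ys)) (map (f x) ys)
      row#rest = All.map⁺ (All.map (λ qy → all-cartesianProductWith f (All.zip (x∉xs , pxs)) qys
                   (λ (x≉x′ , px′) qy′ eq → x≉x′ (proj₁ (inj px px′ qy qy′ eq)))) qys)

    count-product : ∀ {P : A → Set p} {Q : B → Set q} {R : C → Set r} {m n} (f : A → B → C) →
      f Preserves₂ _≈₁_ ⟶ _≈₂_ ⟶ _≈₃_ → InjectiveOn P Q f →
      (∀ z → R z ⇔ (∃₂ λ x y → P x × Q y × z ≈₃ f x y)) →
      HasCount _≈₁_ P m → HasCount _≈₂_ Q n → HasCount _≈₃_ R (m * n)
    count-product {P = P} {Q} f f-cong inj R⇔ countP@(xs , xs! , P⇔ , ≡.refl) countQ@(ys , ys! , Q⇔ , ≡.refl) =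
      cartesianProductWith f xs ys ,
      unique-cartesianProductWith f inj (counted-members S₁ countP) (counted-members S₂ countQ) xs! ys! ,
      (λ z → mk⇔ (into z ∘ to (R⇔ z)) (from (R⇔ z) ∘ outof)) ,
      length-cartesianProductWith f xs ys
      where
      into : ∀ z → (∃₂ λ x y → P x × Q y × z ≈₃ f x y) → Any (z ≈₃_) (cartesianProductWith f xs ys)
      into z (x , y , px , qy , z≈fxy) = Membership.∈-resp-≈ S₃ (sym₃ z≈fxy)
        (Membership.∈-cartesianProductWith⁺ S₁ S₂ S₃ f-cong (to (P⇔ x) px) (to (Q⇔ y) qy))
      outof : ∀ {z} → Any (z ≈₃_) (cartesianProductWith f xs ys) → ∃₂ λ x y → P x × Q y × z ≈₃ f x y
      outof z∈ with Membership.∈-cartesianProductWith⁻ S₁ S₂ S₃ f xs ys z∈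
      ... | x , y , x∈ , y∈ , z≈fxy = x , y , from (P⇔ x) x∈ , from (Q⇔ y) y∈ , z≈fxy

  module _ (S : Setoid a ℓ₁) where
    open Setoid S renaming (Carrier to A)
    open VecEquality S using (_≋_; ≋-setoid)

    ◂-cong : ∀ {n} → _◂_ Preserves₂ _≈_ ⟶ _≋_ {n} ⟶ _≋_
    ◂-cong x≈x′ v≋v′ fz     = x≈x′
    ◂-cong x≈x′ v≋v′ (fs i) = v≋v′ i

    ◂-injective : ∀ {n x x′} {v v′ : Vector A n} → (x ◂ v) ≋ (x′ ◂ v′) → x ≈ x′ × v ≋ v′
    ◂-injective eq = eq fz , eq ∘ fs

    count-vectors : ∀ n {P : Fin n → A → Set p} {k : Fin n → ℕ} →
      (∀ i → HasCount _≈_ (P i) (k i)) → HasCount _≋_ (λ v → ∀ i → P i (v i)) (prodFin k)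
    count-vectors zero    counts = (λ ()) ∷ [] , [] ∷ [] , (λ v → mk⇔ (λ _ → here (λ ())) (λ _ ())) , ≡.refl
    count-vectors (suc n) {P} counts =
      count-product S (≋-setoid n) (≋-setoid (suc n)) _◂_ ◂-cong (λ _ _ _ _ → ◂-injective) split
        (counts fz) (count-vectors n (counts ∘ fs))
      where
      split : ∀ z → (∀ i → P i (z i)) ⇔
              (∃₂ λ x v → P fz x × (∀ i → P (fs i) (v i)) × z ≋ (x ◂ v))
      split z = mk⇔ (λ Pz → head z , tail z , Pz fz , Pz ∘ fs , λ { fz → refl ; (fs i) → refl })
        λ { (x , v , Px , Pv , z≋) fz     → counted-resp S (counts fz) (sym (z≋ fz)) Px
          ; (x , v , Px , Pv , z≋) (fs i) → counted-resp S (counts (fs i)) (sym (z≋ (fs i))) (Pv i) }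

module LinearAlgebra {c ℓ} (R : CommutativeRing c ℓ) (isField : IsField R) where

  open import Data.Nat using (ℕ; zero; suc; s≤s; z≤n; _≤_; _<_; _≡ᵇ_)
  open import Data.Nat.Properties using (<-cmp; ≤-<-trans; <⇒≤; ≤-reflexive; >⇒≢)
  open import Data.Bool using (Bool; true; false; _∨_; if_then_else_)
  open import Data.Bool.Properties using (∨-zeroʳ)
  open import Data.Empty using (⊥-elim)
  open import Data.Fin using (Fin; toℕ; fromℕ<) renaming (zero to fz; suc to fs)
  open import Data.Fin.Properties using (toℕ-fromℕ<; toℕ-injective)
    renaming (suc-injective to fs-injective; 0≢1+n to fz≢fs)
  open import Data.Maybe using (Maybe; just; nothing)
  open import Data.Product using (Σ; ∃₂; _×_; _,_; proj₁; proj₂)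
  open import Data.Unit.Polymorphic using (⊤)
  open import Data.Vec.Functional using (Vector)
  import Data.Vec.Functional.Relation.Binary.Equality.Setoid as VecEquality
  open import Function using (_∘_; _⇔_; mk⇔)
  open import Relation.Nullary using (¬_)
  open import Relation.Binary.Bundles using (Setoid)
  open import Relation.Binary.Definitions using (tri<; tri≈; tri>)
  import Relation.Binary.PropositionalEquality as ≡
  open PositionCounting using (∅; _∪[_]; ≡ᵇ-sound; ≡ᵇ-true; ≡ᵇ-false; entryAt-sound; entryAt-pos)

  open CommutativeRing R
  open Matrices R
  open import Algebra.Properties.Ring ring using (+-cancelˡ; -0#≈0#; -‿distribˡ-*)
  open import Algebra.Properties.Semiring.Sum semiring
    using (sum; sum-cong-≋; sum-cong-≗; ∑-comm; *-distribˡ-sum; *-distribʳ-sum; sum-replicate-zero)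
  open import Relation.Binary.Reasoning.Setoid setoid

  1≉0 : ¬ 1# ≈ 0#
  1≉0 = proj₁ isField

  *-cancelˡ-nonzero : ∀ {a x y} → ¬ a ≈ 0# → a * x ≈ a * y → x ≈ y
  *-cancelˡ-nonzero {a} {x} {y} a≉0 ax≈ay with proj₂ isField a a≉0
  ... | a⁻¹ , aa⁻¹≈1 = begin
    x              ≈⟨ undo x ⟨
    a⁻¹ * (a * x)  ≈⟨ *-congˡ ax≈ay ⟩
    a⁻¹ * (a * y)  ≈⟨ undo y ⟩
    y              ∎
    where
    undo : ∀ z → a⁻¹ * (a * z) ≈ z
    undo z = begin
      a⁻¹ * (a * z)  ≈⟨ *-assoc a⁻¹ a z ⟨
      (a⁻¹ * a) * z  ≈⟨ *-congʳ (trans (*-comm a⁻¹ a) aa⁻¹≈1) ⟩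
      1# * z         ≈⟨ *-identityˡ z ⟩
      z              ∎

  nonzero-* : ∀ {a b} → ¬ a ≈ 0# → ¬ b ≈ 0# → ¬ a * b ≈ 0#
  nonzero-* a≉0 b≉0 ab≈0 = b≉0 (*-cancelˡ-nonzero a≉0 (trans ab≈0 (sym (zeroʳ _))))

  minus-zero : ∀ {x y} → y ≈ 0# → x + - y ≈ x
  minus-zero y≈0 = trans (+-congˡ (trans (-‿cong y≈0) -0#≈0#)) (+-identityʳ _)

  add-cancel : ∀ x y → x + (y + - x) ≈ y
  add-cancel x y = begin
    x + (y + - x)  ≈⟨ +-congˡ (+-comm y (- x)) ⟩
    x + (- x + y)  ≈⟨ +-assoc x (- x) y ⟨
    (x + - x) + y  ≈⟨ +-congʳ (-‿inverseʳ x) ⟩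
    0# + y         ≈⟨ +-identityˡ y ⟩
    y              ∎

  sumF≡sum : ∀ {k} (f : Fin k → Carrier) → sumF f ≡.≡ sum f
  sumF≡sum {zero}  f = ≡.refl
  sumF≡sum {suc k} f = ≡.cong (f fz +_) (sumF≡sum (f ∘ fs))

  sumF-cong : ∀ {k} {f g : Fin k → Carrier} → (∀ i → f i ≈ g i) → sumF f ≈ sumF g
  sumF-cong {f = f} {g} f≈g = begin
    sumF f  ≡⟨ sumF≡sum f ⟩
    sum f   ≈⟨ sum-cong-≋ f≈g ⟩
    sum g   ≡⟨ sumF≡sum g ⟨
    sumF g  ∎

  sumF-zero : ∀ {k} {f : Fin k → Carrier} → (∀ i → f i ≈ 0#) → sumF f ≈ 0#
  sumF-zero {k} f≈0 = trans (sumF-cong f≈0) (trans (reflexive (sumF≡sum {k} (λ _ → 0#))) (sum-replicate-zero k))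

  sumF-*ʳ : ∀ {k} (g : Fin k → Carrier) s → sumF (λ t → g t * s) ≈ sumF g * s
  sumF-*ʳ {zero}  g s = sym (zeroˡ s)
  sumF-*ʳ {suc k} g s = trans (+-congˡ (sumF-*ʳ (g ∘ fs) s)) (sym (distribʳ s (g fz) (sumF (g ∘ fs))))

  sumF-select : ∀ {k} n (n<k : n < k) (g : Fin k → Carrier) →
    sumF (λ t → (if n ≡ᵇ toℕ t then 1# else 0#) * g t) ≈ g (fromℕ< n<k)
  sumF-select {suc k} zero    n<k       g = begin
    1# * g fz + sumF (λ t → 0# * g (fs t))  ≈⟨ +-cong (*-identityˡ _) (sumF-zero {k} (λ t → zeroˡ _)) ⟩
    g fz + 0#                               ≈⟨ +-identityʳ _ ⟩
    g fz                                    ∎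
  sumF-select {suc k} (suc n) (s≤s n<k) g = begin
    0# * g fz + sumF (λ t → (if n ≡ᵇ toℕ t then 1# else 0#) * g (fs t))
      ≈⟨ +-cong (zeroˡ _) (sumF-select n n<k (g ∘ fs)) ⟩
    0# + g (fs (fromℕ< n<k))  ≈⟨ +-identityˡ _ ⟩
    g (fs (fromℕ< n<k))       ∎

  matrixSetoid : ℕ → ℕ → Setoid c ℓ
  matrixSetoid m n = VecEquality.≋-setoid (VecEquality.≋-setoid setoid n) m

  module _ {m n : ℕ} where
    open Setoid (matrixSetoid m n) public using ()
      renaming (refl to ≈ᴹ-refl; sym to ≈ᴹ-sym; trans to ≈ᴹ-trans)

  ·-cong : ∀ {m k n} {A A′ : Matrix m k} {B B′ : Matrix k n} → A ≈ᴹ A′ → B ≈ᴹ B′ → (A · B) ≈ᴹ (A′ · B′)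
  ·-cong A≈A′ B≈B′ i j = sumF-cong (λ t → *-cong (A≈A′ i t) (B≈B′ t j))

  ·-assoc : ∀ {m k l n} (A : Matrix m k) (B : Matrix k l) (C : Matrix l n) → ((A · B) · C) ≈ᴹ (A · (B · C))
  ·-assoc {k = k} {l} A B C i j = begin
    sumF (λ s → sumF (λ t → A i t * B t s) * C s j)
      ≡⟨ ≡.trans (sumF≡sum {l} _) (sum-cong-≗ (λ s → ≡.cong (_* C s j) (sumF≡sum {k} (λ t → A i t * B t s)))) ⟩
    sum (λ s → sum (λ t → A i t * B t s) * C s j)
      ≈⟨ sum-cong-≋ (λ s → *-distribʳ-sum (C s j) (λ t → A i t * B t s)) ⟩
    sum (λ s → sum (λ t → (A i t * B t s) * C s j))
      ≈⟨ ∑-comm (λ s t → (A i t * B t s) * C s j) ⟩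
    sum (λ t → sum (λ s → (A i t * B t s) * C s j))
      ≈⟨ sum-cong-≋ (λ t → sum-cong-≋ (λ s → *-assoc (A i t) (B t s) (C s j))) ⟩
    sum (λ t → sum (λ s → A i t * (B t s * C s j)))
      ≈⟨ sum-cong-≋ (λ t → *-distribˡ-sum (A i t) (λ s → B t s * C s j)) ⟨
    sum (λ t → A i t * sum (λ s → B t s * C s j))
      ≡⟨ ≡.trans (sumF≡sum {k} _) (sum-cong-≗ (λ t → ≡.cong (A i t *_) (sumF≡sum {l} (λ s → B t s * C s j)))) ⟨
    sumF (λ t → A i t * sumF (λ s → B t s * C s j)) ∎

  ·-identityˡ : ∀ {m n} (A : Matrix m n) → (identity · A) ≈ᴹ A
  ·-identityˡ {suc m} A fz j = begin
    1# * A fz j + sumF (λ t → 0# * A (fs t) j)  ≈⟨ +-cong (*-identityˡ _) (sumF-zero {m} (λ t → zeroˡ _)) ⟩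
    A fz j + 0#                                ≈⟨ +-identityʳ _ ⟩
    A fz j                                     ∎
  ·-identityˡ {suc m} A (fs i) j = begin
    0# * A fz j + (identity · (A ∘ fs)) i j    ≈⟨ +-cong (zeroˡ _) (·-identityˡ (A ∘ fs) i j) ⟩
    0# + A (fs i) j                            ≈⟨ +-identityˡ _ ⟩
    A (fs i) j                                 ∎

  identity-lower : ∀ {n} (i j : Fin n) → toℕ j < toℕ i → identity i j ≈ 0#
  identity-lower i j j<i rewrite ≡ᵇ-false (>⇒≢ j<i) = refl

  identity-diagonal : ∀ {n} (i : Fin n) → identity i i ≈ 1#
  identity-diagonal i rewrite ≡ᵇ-true {toℕ i} ≡.refl = refl

  right-inverse-solves : ∀ {n} {M B : Matrix n n} → (M · B) ≈ᴹ identity → ∀ (r : Vector Carrier n) i →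
                         sumF (λ t → M i t * sumF (λ u → B t u * r u)) ≈ r i
  right-inverse-solves {n} {M} {B} MB≈I r i = begin
    sumF (λ t → M i t * sumF (λ u → B t u * r u))  ≈⟨ ·-assoc M B column i fz ⟨
    sumF (λ u → (M · B) i u * r u)                 ≈⟨ ·-cong {B = column} MB≈I (λ _ _ → refl) i fz ⟩
    sumF (λ u → identity i u * r u)                ≈⟨ ·-identityˡ column i fz ⟩
    r i                                            ∎
    where
    column : Matrix n 1
    column u _ = r u

  sub : ∀ {m n} → Matrix (suc m) (suc n) → Matrix m n
  sub A i j = A (fs i) (fs j)

  FirstRowZero : ∀ {m n} → Matrix (suc m) (suc n) → Set ℓ
  FirstRowZero A = ∀ j → A fz (fs j) ≈ 0#

  first-row-· : ∀ {m k n} (A : Matrix (suc m) (suc k)) (B : Matrix (suc k) n) → FirstRowZero A →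
                ∀ j → (A · B) fz j ≈ A fz fz * B fz j
  first-row-· {k = k} A B A₀≈0 j = begin
    A fz fz * B fz j + sumF (λ t → A fz (fs t) * B (fs t) j)
      ≈⟨ +-congˡ (sumF-zero {k} (λ t → trans (*-congʳ (A₀≈0 t)) (zeroˡ _))) ⟩
    A fz fz * B fz j + 0#
      ≈⟨ +-identityʳ _ ⟩
    A fz fz * B fz j ∎

  sub-· : ∀ {m k n} (A : Matrix (suc m) (suc k)) (B : Matrix (suc k) (suc n)) → FirstRowZero B →
          ∀ i j → (A · B) (fs i) (fs j) ≈ (sub A · sub B) i j
  sub-· A B B₀≈0 i j = begin
    A (fs i) fz * B fz (fs j) + (sub A · sub B) i j  ≈⟨ +-congʳ (trans (*-congˡ (B₀≈0 j)) (zeroʳ _)) ⟩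
    0# + (sub A · sub B) i j                        ≈⟨ +-identityˡ _ ⟩
    (sub A · sub B) i j                             ∎

  block : ∀ {n} → Carrier → Vector Carrier n → Matrix n n → Matrix (suc n) (suc n)
  block a r A fz     fz     = a
  block a r A fz     (fs j) = 0#
  block a r A (fs i) fz     = r i
  block a r A (fs i) (fs j) = A i j

  Lower : ∀ {n} → Matrix n n → Set ℓ
  Lower L = ∀ i j → toℕ i < toℕ j → L i j ≈ 0#

  -- Lower triangular matrices with nonzero diagonal: over a field these are
  -- the invertible lower triangular matrices.
  LowerNZ : ∀ {n} → Matrix n n → Set ℓ
  LowerNZ L = Lower L × (∀ i → ¬ L i i ≈ 0#)

  lower-firstRowZero : ∀ {n} {L : Matrix (suc n) (suc n)} → Lower L → FirstRowZero L
  lower-firstRowZero low j = low fz (fs j) (s≤s z≤n)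

  LowerNZ-resp : ∀ {n} {L L′ : Matrix n n} → L ≈ᴹ L′ → LowerNZ L → LowerNZ L′
  LowerNZ-resp L≈L′ (low , diag) =
    (λ i j i<j → trans (sym (L≈L′ i j)) (low i j i<j)) , (λ i L′ᵢᵢ≈0 → diag i (trans (L≈L′ i i) L′ᵢᵢ≈0))

  LowerNZ-sub : ∀ {n} {L : Matrix (suc n) (suc n)} → LowerNZ L → LowerNZ (sub L)
  LowerNZ-sub (low , diag) = (λ i j i<j → low (fs i) (fs j) (s≤s i<j)) , diag ∘ fs

  LowerNZ-intro : ∀ {n} {L : Matrix (suc n) (suc n)} →
    ¬ L fz fz ≈ 0# → FirstRowZero L → LowerNZ (sub L) → LowerNZ L
  LowerNZ-intro {L = L} L₀₀≉0 L₀≈0 (low , diag) = lower , λ { fz → L₀₀≉0 ; (fs i) → diag i }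
    where
    lower : Lower L
    lower fz     (fs j) _         = L₀≈0 j
    lower (fs i) (fs j) (s≤s i<j) = low i j i<j

  LowerNZ-block : ∀ {n} {L : Matrix (suc n) (suc n)} → LowerNZ L →
                  L ≈ᴹ block (L fz fz) (λ i → L (fs i) fz) (sub L)
  LowerNZ-block h         fz     fz     = refl
  LowerNZ-block (low , _) fz     (fs j) = lower-firstRowZero low j
  LowerNZ-block h         (fs i) fz     = refl
  LowerNZ-block h         (fs i) (fs j) = refl

  block-LowerNZ : ∀ {n a r} {A : Matrix n n} → ¬ a ≈ 0# → LowerNZ A → LowerNZ (block a r A)
  block-LowerNZ a≉0 h = LowerNZ-intro a≉0 (λ _ → refl) h

  -- LowerNZ is closed under products: the corner of a product is the product
  -- of the (nonzero) corners.
  LowerNZ-· : ∀ {n} {L A : Matrix n n} → LowerNZ L → LowerNZ A → LowerNZ (L · A)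
  LowerNZ-· {zero}          hL hA = (λ ()) , (λ ())
  LowerNZ-· {suc n} {L} {A} hL hA = LowerNZ-intro corner first-row
    (LowerNZ-resp (λ i j → sym (sub-· L A (lower-firstRowZero (proj₁ hA)) i j))
                  (LowerNZ-· (LowerNZ-sub hL) (LowerNZ-sub hA)))
    where
    L₀≈0 = lower-firstRowZero (proj₁ hL)
    corner : ¬ (L · A) fz fz ≈ 0#
    corner LA≈0 = nonzero-* (proj₂ hL fz) (proj₂ hA fz) (trans (sym (first-row-· L A L₀≈0 fz)) LA≈0)
    first-row : FirstRowZero (L · A)
    first-row j = trans (first-row-· L A L₀≈0 (fs j))
                        (trans (*-congˡ (lower-firstRowZero (proj₁ hA) j)) (zeroʳ _))

  invertible-LowerNZ : ∀ {n} {L : Matrix n n} → Lower L → Invertible L → LowerNZ L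
  invertible-LowerNZ {zero}      low _                  = low , (λ ())
  invertible-LowerNZ {suc n} {L} low (B , LB≈I , BL≈I) =
    LowerNZ-intro corner L₀≈0 (invertible-LowerNZ (λ i j i<j → low (fs i) (fs j) (s≤s i<j)) (sub B , sub-LB , sub-BL))
    where
    L₀≈0 = lower-firstRowZero low
    first-row : ∀ j → L fz fz * B fz j ≈ identity fz j
    first-row j = trans (sym (first-row-· L B L₀≈0 j)) (LB≈I fz j)
    corner : ¬ L fz fz ≈ 0#
    corner L₀₀≈0 = 1≉0 (begin
      1#                 ≈⟨ first-row fz ⟨
      L fz fz * B fz fz  ≈⟨ *-congʳ L₀₀≈0 ⟩
      0# * B fz fz       ≈⟨ zeroˡ _ ⟩
      0#                 ∎)
    B₀≈0 : FirstRowZero B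
    B₀≈0 j = *-cancelˡ-nonzero corner (trans (first-row (fs j)) (sym (zeroʳ _)))
    sub-LB : (sub L · sub B) ≈ᴹ identity
    sub-LB i j = trans (sym (sub-· L B B₀≈0 i j)) (LB≈I (fs i) (fs j))
    sub-BL : (sub B · sub L) ≈ᴹ identity
    sub-BL i j = trans (sym (sub-· B L L₀≈0 i j)) (BL≈I (fs i) (fs j))

  -- Conversely, a lower triangular matrix with nonzero diagonal is
  -- invertible.  With L = block a r L′ and L′ B′ = B′ L′ = 1, the inverse is
  -- block a⁻¹ (- a⁻¹ B′ r) B′.
  LowerNZ-invertible : ∀ {n} {L : Matrix n n} → LowerNZ L → Invertible L
  LowerNZ-invertible {zero}      _ = (λ ()) , (λ ()) , (λ ())
  LowerNZ-invertible {suc n} {L} h with proj₂ isField (L fz fz) (proj₂ h fz) | LowerNZ-invertible (LowerNZ-sub h)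
  ... | a⁻¹ , aa⁻¹≈1 | B′ , L′B′≈I , B′L′≈I = B , LB≈I , BL≈I
    where
    a = L fz fz
    r = λ i → L (fs i) fz
    y = λ i → sumF (λ t → B′ i t * r t)
    B = block a⁻¹ (λ i → y i * - a⁻¹) B′
    L₀≈0 = lower-firstRowZero (proj₁ h)
    a⁻¹a≈1 : a⁻¹ * a ≈ 1#
    a⁻¹a≈1 = trans (*-comm a⁻¹ a) aa⁻¹≈1
    LB≈I : (L · B) ≈ᴹ identity
    LB≈I fz     fz     = trans (first-row-· L B L₀≈0 fz) aa⁻¹≈1
    LB≈I fz     (fs j) = trans (first-row-· L B L₀≈0 (fs j)) (zeroʳ a)
    LB≈I (fs i) fz     = begin
      r i * a⁻¹ + sumF (λ t → sub L i t * (y t * - a⁻¹))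
        ≈⟨ +-congˡ (trans (sumF-cong {n} (λ t → sym (*-assoc _ _ _))) (sumF-*ʳ (λ t → sub L i t * y t) (- a⁻¹))) ⟩
      r i * a⁻¹ + sumF (λ t → sub L i t * y t) * - a⁻¹
        ≈⟨ +-congˡ (*-congʳ (right-inverse-solves L′B′≈I r i)) ⟩
      r i * a⁻¹ + r i * - a⁻¹
        ≈⟨ distribˡ (r i) a⁻¹ (- a⁻¹) ⟨
      r i * (a⁻¹ + - a⁻¹)
        ≈⟨ trans (*-congˡ (-‿inverseʳ a⁻¹)) (zeroʳ _) ⟩
      0# ∎
    LB≈I (fs i) (fs j) = trans (sub-· L B (λ _ → refl) i j) (L′B′≈I i j)
    BL≈I : (B · L) ≈ᴹ identity
    BL≈I fz     fz     = trans (first-row-· B L (λ _ → refl) fz) a⁻¹a≈1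
    BL≈I fz     (fs j) = trans (first-row-· B L (λ _ → refl) (fs j)) (trans (*-congˡ (L₀≈0 j)) (zeroʳ _))
    BL≈I (fs i) fz     = begin
      y i * - a⁻¹ * a + y i          ≈⟨ +-cong (*-assoc _ _ _) (sym (*-identityʳ _)) ⟩
      y i * (- a⁻¹ * a) + y i * 1#   ≈⟨ distribˡ (y i) _ _ ⟨
      y i * (- a⁻¹ * a + 1#)         ≈⟨ *-congˡ (+-congʳ (sym (-‿distribˡ-* a⁻¹ a))) ⟩
      y i * (- (a⁻¹ * a) + 1#)       ≈⟨ *-congˡ (trans (+-congʳ (-‿cong a⁻¹a≈1)) (-‿inverseˡ 1#)) ⟩
      y i * 0#                       ≈⟨ zeroʳ _ ⟩
      0#                             ∎
    BL≈I (fs i) (fs j) = trans (sub-· B L L₀≈0 i j) (B′L′≈I i j)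

  ColumnOK : ℕ → (ℕ → Bool) → ℕ → Carrier → Set ℓ
  ColumnOK p Z x v = (x < p → v ≈ 0#) × (x ≡.≡ p → v ≈ 1#) × (Z x ≡.≡ true → v ≈ 0#)

  RowOK : ∀ {W} → ℕ → (ℕ → Bool) → Vector Carrier W → Set ℓ
  RowOK p Z v = ∀ c → ColumnOK p Z (toℕ c) (v c)

  Echelon : ∀ {n W} → (Fin n → ℕ) → (ℕ → Bool) → Matrix n W → Set ℓ
  Echelon {zero}  p Z V = ⊤
  Echelon {suc n} p Z V = RowOK (p fz) Z (V fz) × Echelon (p ∘ fs) (Z ∪[ p fz ]) (V ∘ fs)

  Echelon-row : ∀ {n W} (p : Fin n → ℕ) Z {V : Matrix n W} → Echelon p Z V →
                ∀ k c → (toℕ c < p k → V k c ≈ 0#) × (toℕ c ≡.≡ p k → V k c ≈ 1#)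
  Echelon-row p Z (row , _)   fz     c = proj₁ (row c) , proj₁ (proj₂ (row c))
  Echelon-row p Z (_ , rows) (fs k) c = Echelon-row (p ∘ fs) (Z ∪[ p fz ]) rows k c

  Echelon-occupied : ∀ {n W} (p : Fin n → ℕ) Z {V : Matrix n W} → Echelon p Z V →
                     ∀ k c → Z (toℕ c) ≡.≡ true → V k c ≈ 0#
  Echelon-occupied p Z (row , _)   fz     c Zc = proj₂ (proj₂ (row c)) Zc
  Echelon-occupied p Z (_ , rows) (fs k) c Zc =
    Echelon-occupied (p ∘ fs) (Z ∪[ p fz ]) rows k c (≡.cong (_∨ _) Zc)

  clear-RowOK : ∀ {W p₀ p′ Z} {v u : Vector Carrier W} (col : Fin W) → toℕ col ≡.≡ p₀ → p₀ ≡.≢ p′ →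
    RowOK p₀ Z v → RowOK p′ Z u → RowOK p′ (Z ∪[ p₀ ]) (λ c → u c + - (u col * v c))
  clear-RowOK {p₀ = p₀} {p′} {Z} {v} {u} col col≡p₀ p₀≢p′ v-ok u-ok c = before , at , occupied
    where
    a = u col
    untouched : toℕ c ≤ p′ → a * v c ≈ 0#
    untouched x≤p′ with <-cmp p₀ p′
    ... | tri< p₀<p′ _ _ = trans (*-congʳ (proj₁ (u-ok col) (≡.subst (_< p′) (≡.sym col≡p₀) p₀<p′))) (zeroˡ _)
    ... | tri≈ _ p₀≡p′ _ = ⊥-elim (p₀≢p′ p₀≡p′)
    ... | tri> _ _ p′<p₀ = trans (*-congˡ (proj₁ (v-ok c) (≤-<-trans x≤p′ p′<p₀))) (zeroʳ _)
    before : toℕ c < p′ → u c + - (a * v c) ≈ 0#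
    before x<p′ = trans (minus-zero (untouched (<⇒≤ x<p′))) (proj₁ (u-ok c) x<p′)
    at : toℕ c ≡.≡ p′ → u c + - (a * v c) ≈ 1#
    at x≡p′ = trans (minus-zero (untouched (≤-reflexive x≡p′))) (proj₁ (proj₂ (u-ok c)) x≡p′)
    pivot-cleared : a + - (a * v col) ≈ 0#
    pivot-cleared = begin
      a + - (a * v col)  ≈⟨ +-congˡ (-‿cong (*-congˡ (proj₁ (proj₂ (v-ok col)) col≡p₀))) ⟩
      a + - (a * 1#)     ≈⟨ +-congˡ (-‿cong (*-identityʳ a)) ⟩
      a + - a            ≈⟨ -‿inverseʳ a ⟩
      0#                 ∎
    occupied : Z (toℕ c) ∨ (p₀ ≡ᵇ toℕ c) ≡.≡ true → u c + - (a * v c) ≈ 0#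
    occupied _ with Z (toℕ c) in Zc | p₀ ≡ᵇ toℕ c in p₀≡c
    ... | true  | _    = trans (minus-zero (trans (*-congˡ (proj₂ (proj₂ (v-ok c)) Zc)) (zeroʳ a)))
                               (proj₂ (proj₂ (u-ok c)) Zc)
    ... | false | true = ≡.subst (λ c → u c + - (a * v c) ≈ 0#) (≡.sym c≡col) pivot-cleared
      where
      c≡col : c ≡.≡ col
      c≡col = toℕ-injective (≡.trans (≡.sym (≡ᵇ-sound p₀≡c)) (≡.sym col≡p₀))

  echelon-exists : ∀ {n W} (p : Fin n → ℕ) Z → (∀ {i j} → p i ≡.≡ p j → i ≡.≡ j) → (∀ k → p k < W) →
    (V₀ : Matrix n W) → (∀ k → RowOK (p k) Z (V₀ k)) →
    Σ (Matrix n W) λ V → Σ (Matrix n n) λ A → Echelon p Z V × LowerNZ A × V₀ ≈ᴹ (A · V)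
  echelon-exists {zero}  p Z p-inj p<W V₀ ok = V₀ , (λ ()) , _ , ((λ ()) , (λ ())) , (λ ())
  echelon-exists {suc n} {W} p Z p-inj p<W V₀ ok = V , A , (ok fz , ech′) , block-LowerNZ 1≉0 lowA′ , V₀≈AV
    where
    col = fromℕ< (p<W fz)
    v = V₀ fz
    a = λ k → V₀ (fs k) col
    cleared : Matrix n W
    cleared k c = V₀ (fs k) c + - (a k * v c)
    cleared-ok : ∀ k → RowOK (p (fs k)) (Z ∪[ p fz ]) (cleared k)
    cleared-ok k = clear-RowOK {Z = Z} col (toℕ-fromℕ< (p<W fz)) (fz≢fs ∘ p-inj) (ok fz) (ok (fs k))
    reduced = echelon-exists (p ∘ fs) (Z ∪[ p fz ]) (fs-injective ∘ p-inj) (p<W ∘ fs) cleared cleared-ok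
    V′ = proj₁ reduced
    A′ = proj₁ (proj₂ reduced)
    ech′ = proj₁ (proj₂ (proj₂ reduced))
    lowA′ = proj₁ (proj₂ (proj₂ (proj₂ reduced)))
    cleared≈A′V′ = proj₂ (proj₂ (proj₂ (proj₂ reduced)))
    V : Matrix (suc n) W
    V fz     = v
    V (fs k) = V′ k
    A = block 1# a A′
    V₀≈AV : V₀ ≈ᴹ (A · V)
    V₀≈AV fz     c = sym (trans (first-row-· A V (λ _ → refl) c) (*-identityˡ (v c)))
    V₀≈AV (fs k) c = sym (begin
      a k * v c + (A′ · V′) k c   ≈⟨ +-congˡ (cleared≈A′V′ k c) ⟨
      a k * v c + cleared k c     ≈⟨ add-cancel (a k * v c) (V₀ (fs k) c) ⟩
      V₀ (fs k) c                 ∎)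

  -- In a product L · V with V in echelon form, the pivot column of the first
  -- row reads off the first column of L, since the lower rows of V vanish there.
  pivot-column : ∀ {n W} (p : Fin (suc n) → ℕ) Z {L : Matrix (suc n) (suc n)} {V : Matrix (suc n) W}
    (col : Fin W) → toℕ col ≡.≡ p fz → Echelon p Z V → ∀ i → (L · V) (fs i) col ≈ L (fs i) fz
  pivot-column {n} p Z {L} {V} col col≡p₀ (row , rows) i = begin
    L (fs i) fz * V fz col + sumF (λ t → L (fs i) (fs t) * V (fs t) col)
      ≈⟨ +-cong (*-congˡ (proj₁ (proj₂ (row col)) col≡p₀)) (sumF-zero {n} (λ t → trans (*-congˡ (lower-rows t)) (zeroʳ _))) ⟩
    L (fs i) fz * 1# + 0#
      ≈⟨ trans (+-identityʳ _) (*-identityʳ _) ⟩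
    L (fs i) fz ∎
    where
    occupied : (Z ∪[ p fz ]) (toℕ col) ≡.≡ true
    occupied rewrite col≡p₀ | ≡ᵇ-true {p fz} ≡.refl = ∨-zeroʳ (Z (p fz))
    lower-rows : ∀ t → V (fs t) col ≈ 0#
    lower-rows t = Echelon-occupied (p ∘ fs) (Z ∪[ p fz ]) rows t col occupied

  echelon-unique : ∀ {n W} (p : Fin n → ℕ) Z → (∀ k → p k < W) →
    ∀ {L L′ : Matrix n n} {V V′ : Matrix n W} → LowerNZ L → LowerNZ L′ → Echelon p Z V → Echelon p Z V′ →
    (L · V) ≈ᴹ (L′ · V′) → L ≈ᴹ L′ × V ≈ᴹ V′
  echelon-unique {zero}  p Z p<W _ _ _ _ _ = (λ ()) , (λ ())
  echelon-unique {suc n} p Z p<W {L} {L′} {V} {V′} hL hL′ ech@(row , rows) ech′@(row′ , rows′) LV≈L′V′ =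
    L≈L′ , V≈V′
    where
    col = fromℕ< (p<W fz)
    col≡p₀ = toℕ-fromℕ< (p<W fz)
    first-rows : ∀ c → L fz fz * V fz c ≈ L′ fz fz * V′ fz c
    first-rows c = trans (sym (first-row-· L V (lower-firstRowZero (proj₁ hL)) c))
                         (trans (LV≈L′V′ fz c) (first-row-· L′ V′ (lower-firstRowZero (proj₁ hL′)) c))
    corner : L fz fz ≈ L′ fz fz
    corner = begin
      L fz fz                ≈⟨ trans (*-congˡ (proj₁ (proj₂ (row col)) col≡p₀)) (*-identityʳ _) ⟨
      L fz fz * V fz col     ≈⟨ first-rows col ⟩
      L′ fz fz * V′ fz col   ≈⟨ trans (*-congˡ (proj₁ (proj₂ (row′ col)) col≡p₀)) (*-identityʳ _) ⟩
      L′ fz fz               ∎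
    first-row-V : ∀ c → V fz c ≈ V′ fz c
    first-row-V c = *-cancelˡ-nonzero (proj₂ hL fz) (trans (first-rows c) (*-congʳ (sym corner)))
    first-column : ∀ i → L (fs i) fz ≈ L′ (fs i) fz
    first-column i = trans (sym (pivot-column p Z {L} {V} col col≡p₀ ech i))
                           (trans (LV≈L′V′ (fs i) col) (pivot-column p Z {L′} {V′} col col≡p₀ ech′ i))
    lower-blocks : (sub L · (V ∘ fs)) ≈ᴹ (sub L′ · (V′ ∘ fs))
    lower-blocks i c = +-cancelˡ (L (fs i) fz * V fz c) _ _
      (trans (LV≈L′V′ (fs i) c) (+-congʳ (sym (*-cong (first-column i) (first-row-V c)))))
    rest = echelon-unique (p ∘ fs) (Z ∪[ p fz ]) (p<W ∘ fs) (LowerNZ-sub hL) (LowerNZ-sub hL′) rows rows′ lower-blocks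
    L≈L′ : L ≈ᴹ L′
    L≈L′ fz     fz     = corner
    L≈L′ fz     (fs j) = trans (lower-firstRowZero (proj₁ hL) j) (sym (lower-firstRowZero (proj₁ hL′) j))
    L≈L′ (fs i) fz     = first-column i
    L≈L′ (fs i) (fs j) = proj₁ rest i j
    V≈V′ : V ≈ᴹ V′
    V≈V′ fz     c = first-row-V c
    V≈V′ (fs k) c = proj₂ rest k c

  module Orbit {b W : ℕ} (τ : FlagState b) (p<W : ∀ k → pos τ k < W) where

    p = pos τ
    P = permMatrix τ W

    pivotCol : Fin b → Fin W
    pivotCol k = fromℕ< (p<W k)

    P-· : ∀ (U : Matrix W W) k c → (P · U) k c ≈ U (pivotCol k) c
    P-· U k c = sumF-select (p k) (p<W k) (λ t → U t c)

    complete : Matrix b W → Matrix W W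
    complete V c = completeRow (entryAt p (toℕ c))
      where
      completeRow : Maybe (Fin b) → Vector Carrier W
      completeRow (just k) = V k
      completeRow nothing  = identity c

    P-complete : ∀ V → (P · complete V) ≈ᴹ V
    P-complete V k c = trans (P-· (complete V) k c) (reflexive selects-row-k)
      where
      selects-row-k : complete V (pivotCol k) c ≡.≡ V k c
      selects-row-k rewrite toℕ-fromℕ< (p<W k) | entryAt-pos p (pos-injective τ) k = ≡.refl

    complete-upper : ∀ {Z} V → Echelon p Z V → UpperUnitriangular (complete V)
    complete-upper {Z} V ech = upper , diagonal
      where
      upper : ∀ i j → toℕ j < toℕ i → complete V i j ≈ 0#
      upper i j j<i with entryAt p (toℕ i) in eq
      ... | just k  = proj₁ (Echelon-row p Z ech k j) (≡.subst (toℕ j <_) (≡.sym (entryAt-sound p (toℕ i) k eq)) j<i)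
      ... | nothing = identity-lower i j j<i
      diagonal : ∀ i → complete V i i ≈ 1#
      diagonal i with entryAt p (toℕ i) in eq
      ... | just k  = proj₂ (Echelon-row p Z ech k i) (≡.sym (entryAt-sound p (toℕ i) k eq))
      ... | nothing = identity-diagonal i

    P-·-rows : ∀ {U : Matrix W W} → UpperUnitriangular U → ∀ k → RowOK (p k) ∅ ((P · U) k)
    P-·-rows {U} (upper , diagonal) k c = before , at , (λ ())
      where
      col≡p = toℕ-fromℕ< (p<W k)
      before : toℕ c < p k → (P · U) k c ≈ 0#
      before c<p = trans (P-· U k c) (upper (pivotCol k) c (≡.subst (toℕ c <_) (≡.sym col≡p) c<p))
      at : toℕ c ≡.≡ p k → (P · U) k c ≈ 1#
      at c≡p = trans (P-· U k c) (≡.subst (λ c′ → U (pivotCol k) c′ ≈ 1#)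
                                          (toℕ-injective (≡.trans col≡p (≡.sym c≡p)))
                                          (diagonal (pivotCol k)))

    orbit⇔factorisation : ∀ M → SigmaIs M τ ⇔ (∃₂ λ L V → LowerNZ L × Echelon p ∅ V × M ≈ᴹ (L · V))
    orbit⇔factorisation M = mk⇔ factorise orbit
      where
      -- M = L P U = L (A V) = (L A) V, where P U = A V is the echelon form of P U.
      factorise : SigmaIs M τ → ∃₂ λ L V → LowerNZ L × Echelon p ∅ V × M ≈ᴹ (L · V)
      factorise (L , U , (low , inv) , upper , M≈LPU) =
        L · A , V , LowerNZ-· (invertible-LowerNZ low inv) lowA , ech ,
        ≈ᴹ-trans M≈LPU (≈ᴹ-trans (·-assoc L P U) (≈ᴹ-trans (·-cong ≈ᴹ-refl PU≈AV) (≈ᴹ-sym (·-assoc L A V))))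
        where
        reduced = echelon-exists p ∅ (pos-injective τ) p<W (P · U) (P-·-rows upper)
        V = proj₁ reduced
        A = proj₁ (proj₂ reduced)
        ech = proj₁ (proj₂ (proj₂ reduced))
        lowA = proj₁ (proj₂ (proj₂ (proj₂ reduced)))
        PU≈AV = proj₂ (proj₂ (proj₂ (proj₂ reduced)))
      -- M = L V = L (P (complete V)) = (L P) (complete V).
      orbit : (∃₂ λ L V → LowerNZ L × Echelon p ∅ V × M ≈ᴹ (L · V)) → SigmaIs M τ
      orbit (L , V , hL , ech , M≈LV) =
        L , complete V , (proj₁ hL , LowerNZ-invertible hL) , complete-upper V ech ,
        ≈ᴹ-trans M≈LV (≈ᴹ-trans (·-cong ≈ᴹ-refl (≈ᴹ-sym (P-complete V))) (≈ᴹ-sym (·-assoc L P (complete V))))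

module MatrixCounting {c ℓ} (R : CommutativeRing c ℓ) (isField : IsField R) (q : ℕ) (hasSize : HasSize R q) where

  open import Data.Nat using (zero; suc; _<_; _≡ᵇ_; _*_; _^_; _∸_; _+_)
  open import Data.Nat.Properties using (^-distribˡ-+-*; <-cmp; <⇒≢; >⇒≢; <-irrefl; <-asym; *-commutativeSemigroup)
  open import Algebra.Properties.CommutativeSemigroup *-commutativeSemigroup using (interchange)
  open import Data.Fin using (Fin; toℕ) renaming (zero to fz; suc to fs)
  open import Data.Fin.Properties using () renaming (suc-injective to fs-injective; 0≢1+n to fz≢fs)
  open import Data.Bool using (Bool; true; false; if_then_else_)
  open import Data.Product using (_×_; _,_; ∃₂; proj₁; proj₂)
  open import Data.Product.Relation.Binary.Pointwise.NonDependent using (×-setoid)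
  open import Data.List using ([]; _∷_)
  open import Data.List.Relation.Unary.Any using (here)
  open import Data.List.Relation.Unary.All using ([])
  open import Data.List.Relation.Unary.AllPairs using ([]; _∷_)
  open import Data.Unit.Polymorphic using (⊤; tt)
  open import Data.Vec.Functional using (Vector) renaming (_∷_ to _◂_)
  import Data.Vec.Functional.Relation.Binary.Equality.Setoid as VecEquality
  open import Function using (_∘_; _⇔_; mk⇔; Equivalence)
  open import Relation.Nullary using (¬_; contradiction)
  open import Relation.Binary.Bundles using (Setoid)
  open import Relation.Binary.Definitions using (tri<; tri≈; tri>)
  import Relation.Binary.PropositionalEquality as ≡

  open CommutativeRing R using (Carrier; _≈_; 0#; 1#; setoid; refl; sym; trans)
  open Matrices R
  open LinearAlgebra R isField
  open Enumeration
  open PositionCounting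
  open VecEquality setoid using (_≋_; ≋-setoid)
  open Equivalence using (to; from)

  count-nonzero : HasCount _≈_ (λ x → ¬ x ≈ 0#) (q ∸ 1)
  count-nonzero = counted-cong setoid (λ x → mk⇔ proj₂ (tt ,_)) (count-remove setoid hasSize tt)

  count-free-vectors : ∀ n → HasCount _≋_ (λ v → ∀ (i : Fin n) → ⊤ {ℓ}) (q ^ n)
  count-free-vectors n = ≡.subst (HasCount _≋_ _) q^n (count-vectors setoid n (λ _ → hasSize))
    where
    q^n : prodFin {n} (λ _ → q) ≡.≡ q ^ n
    q^n = ≡.trans (prodFin-pow q n (λ _ → true)) (≡.cong (q ^_) (count-true n))

  cornerSetoid : ℕ → _
  cornerSetoid n = ×-setoid setoid (≋-setoid n)

  count-corners : ∀ n → HasCount (Setoid._≈_ (cornerSetoid n)) (λ ar → ¬ proj₁ ar ≈ 0#) ((q ∸ 1) * q ^ n)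
  count-corners n =
    count-product setoid (≋-setoid n) (cornerSetoid n) _,_ _,_ (λ _ _ _ _ eq → eq) split
      count-nonzero (count-free-vectors n)
    where
    split : ∀ ar → (¬ proj₁ ar ≈ 0#) ⇔ (∃₂ λ a r → ¬ a ≈ 0# × (∀ i → ⊤ {ℓ}) × Setoid._≈_ (cornerSetoid n) ar (a , r))
    split (a , r) = mk⇔ (λ a≉0 → a , r , a≉0 , (λ _ → tt) , (refl , λ _ → refl))
                        (λ (a′ , r′ , a′≉0 , _ , (a≈a′ , _)) a≈0 → a′≉0 (trans (sym a≈a′) a≈0))

  -- There are (q-1)^n q^(n(n-1)/2) lower triangular n × n matrices with
  -- nonzero diagonal: a nonzero corner, a free first column and, recursively,
  -- the lower right block.
  count-LowerNZ : ∀ n → HasCount _≈ᴹ_ (LowerNZ {n}) ((q ∸ 1) ^ n * q ^ triangle n)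
  count-LowerNZ zero    = (λ ()) ∷ [] , [] ∷ [] , (λ L → mk⇔ (λ _ → here (λ ())) (λ _ → (λ ()) , (λ ()))) , ≡.refl
  count-LowerNZ (suc n) = ≡.subst (HasCount _≈ᴹ_ LowerNZ) count≡
    (count-product (cornerSetoid n) (matrixSetoid n n) (matrixSetoid (suc n) (suc n)) blockOf blockOf-cong
       (λ _ _ _ _ eq → (eq fz fz , λ i → eq (fs i) fz) , λ i j → eq (fs i) (fs j)) split
       (count-corners n) (count-LowerNZ n))
    where
    blockOf : Carrier × Vector Carrier n → Matrix n n → Matrix (suc n) (suc n)
    blockOf (a , r) A = block a r A
    blockOf-cong : ∀ {ar ar′ A A′} → Setoid._≈_ (cornerSetoid n) ar ar′ → A ≈ᴹ A′ → blockOf ar A ≈ᴹ blockOf ar′ A′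
    blockOf-cong (a≈a′ , r≋r′) A≈A′ fz     fz     = a≈a′
    blockOf-cong (a≈a′ , r≋r′) A≈A′ fz     (fs j) = refl
    blockOf-cong (a≈a′ , r≋r′) A≈A′ (fs i) fz     = r≋r′ i
    blockOf-cong (a≈a′ , r≋r′) A≈A′ (fs i) (fs j) = A≈A′ i j
    split : ∀ L → LowerNZ L ⇔ (∃₂ λ ar A → ¬ proj₁ ar ≈ 0# × LowerNZ A × L ≈ᴹ blockOf ar A)
    split L = mk⇔ (λ h → (L fz fz , λ i → L (fs i) fz) , sub L , proj₂ h fz , LowerNZ-sub h , LowerNZ-block h)
                  (λ ((a , r) , A , a≉0 , hA , L≈) → LowerNZ-resp (≈ᴹ-sym L≈) (block-LowerNZ a≉0 hA))
    count≡ : ((q ∸ 1) * q ^ n) * ((q ∸ 1) ^ n * q ^ triangle n) ≡.≡ (q ∸ 1) ^ suc n * q ^ (n + triangle n)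
    count≡ = ≡.trans (interchange (q ∸ 1) (q ^ n) _ _) (≡.cong ((q ∸ 1) ^ suc n *_) (≡.sym (^-distribˡ-+-* q n (triangle n))))

  Cell : Bool → Carrier → Carrier → Set ℓ
  Cell true  fixed v = ⊤
  Cell false fixed v = v ≈ fixed

  count-cell : ∀ b fixed → HasCount _≈_ (Cell b fixed) (if b then q else 1)
  count-cell true  fixed = hasSize
  count-cell false fixed = count-singleton setoid fixed

  pivotValue : ℕ → ℕ → Carrier
  pivotValue p x = if x ≡ᵇ p then 1# else 0#

  column⇔cell : ∀ p (Z : ℕ → Bool) x v → Z p ≡.≡ false →
                ColumnOK p Z x v ⇔ Cell (free p Z x) (pivotValue p x) v
  column⇔cell p Z x v Zp≡false with <-cmp x p
  ... | tri< x<p _ _ rewrite <ᵇ-false (<-asym x<p) | ≡ᵇ-false (<⇒≢ x<p) =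
    mk⇔ (λ ok → proj₁ ok x<p) (λ v≈0 → (λ _ → v≈0) , (λ x≡p → contradiction x≡p (<⇒≢ x<p)) , (λ _ → v≈0))
  ... | tri≈ _ ≡.refl _ rewrite <ᵇ-false (<-irrefl {x} ≡.refl) | ≡ᵇ-true {x} ≡.refl =
    mk⇔ (λ ok → proj₁ (proj₂ ok) ≡.refl)
        (λ v≈1 → (λ x<x → contradiction x<x (<-irrefl ≡.refl)) , (λ _ → v≈1) ,
                 (λ Zx≡true → contradiction (≡.trans (≡.sym Zx≡true) Zp≡false) λ ()))
  ... | tri> _ _ p<x rewrite <ᵇ-true p<x | ≡ᵇ-false (>⇒≢ p<x) with Z x
  ...   | true  = mk⇔ (λ ok → proj₂ (proj₂ ok) ≡.refl)
                      (λ v≈0 → (λ x<p → contradiction x<p (<-asym p<x)) , (λ x≡p → contradiction x≡p (>⇒≢ p<x)) ,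
                               (λ _ → v≈0))
  ...   | false = mk⇔ (λ _ → tt)
                      (λ _ → (λ x<p → contradiction x<p (<-asym p<x)) , (λ x≡p → contradiction x≡p (>⇒≢ p<x)) ,
                             (λ ()))

  count-row : ∀ W p (Z : ℕ → Bool) → Z p ≡.≡ false → HasCount _≋_ (RowOK {W} p Z) (q ^ count W (free p Z))
  count-row W p Z Zp≡false =
    ≡.subst (HasCount _≋_ (RowOK p Z)) (prodFin-pow q W (free p Z))
      (counted-cong (≋-setoid W) cells⇔row
        (count-vectors setoid W (λ c → count-cell (free p Z (toℕ c)) (pivotValue p (toℕ c)))))
    where
    cells⇔row : ∀ v → (∀ c → Cell (free p Z (toℕ c)) (pivotValue p (toℕ c)) (v c)) ⇔ RowOK p Z v
    cells⇔row v = mk⇔ (λ cells c → from (column⇔cell p Z (toℕ c) (v c) Zp≡false) (cells c))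
                      (λ row c → to (column⇔cell p Z (toℕ c) (v c) Zp≡false) (row c))

  count-echelon : ∀ W {n} (p : Fin n → ℕ) (Z : ℕ → Bool) → (∀ {i j} → p i ≡.≡ p j → i ≡.≡ j) →
    (∀ k → Z (p k) ≡.≡ false) → HasCount _≈ᴹ_ (Echelon {n} {W} p Z) (q ^ freeCells W p Z)
  count-echelon W {zero}  p Z p-inj unoccupied =
    (λ ()) ∷ [] , [] ∷ [] , (λ V → mk⇔ (λ _ → here (λ ())) (λ _ → tt)) , ≡.refl
  count-echelon W {suc n} p Z p-inj unoccupied =
    ≡.subst (HasCount _≈ᴹ_ (Echelon p Z)) (≡.sym (^-distribˡ-+-* q (count W (free (p fz) Z)) (freeCells W (p ∘ fs) Z′)))
      (count-product (≋-setoid W) (matrixSetoid n W) (matrixSetoid (suc n) W) _◂_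
         (◂-cong (≋-setoid W)) (λ _ _ _ _ → ◂-injective (≋-setoid W)) split count-first count-rest)
    where
    Z′ = Z ∪[ p fz ]
    count-first = count-row W (p fz) Z (unoccupied fz)
    count-rest = count-echelon W (p ∘ fs) Z′ (fs-injective ∘ p-inj)
                   (λ k → ∪-unoccupied {Z} (unoccupied (fs k)) (fz≢fs ∘ p-inj))
    split : ∀ V → Echelon p Z V ⇔ (∃₂ λ v V′ → RowOK (p fz) Z v × Echelon (p ∘ fs) Z′ V′ × V ≈ᴹ (v ◂ V′))
    split V = mk⇔ (λ (row , rows) → V fz , V ∘ fs , row , rows , λ { fz c → refl ; (fs k) c → refl })
      (λ (v , V′ , row , rows , V≈) → counted-resp (≋-setoid W) count-first (λ c → sym (V≈ fz c)) row ,
                                      counted-resp (matrixSetoid n W) count-rest (λ k c → sym (V≈ (fs k) c)) rows)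

  -- The matrices in the orbit of the flag juggling state τ: by the unique
  -- factorisation M = L · V, a product of the two counts.
  count-orbit : ∀ {b W} (τ : FlagState b) (p<W : ∀ k → pos τ k < W) →
    HasCount _≈ᴹ_ (λ M → SigmaIs M τ) (((q ∸ 1) ^ b * q ^ triangle b) * q ^ freeCells W (pos τ) ∅)
  count-orbit {b} {W} τ p<W =
    count-product (matrixSetoid b b) (matrixSetoid b W) (matrixSetoid b W) _·_ ·-cong
      (λ hL hL′ ech ech′ → echelon-unique (pos τ) ∅ p<W hL hL′ ech ech′)
      orbit⇔factorisation (count-LowerNZ b) (count-echelon W (pos τ) ∅ (pos-injective τ) (λ _ → ≡.refl))
    where open Orbit τ p<W

open import Level using (Level)
open import Data.Nat using (_≤_; _<_; _+_; _*_; _^_; _∸_)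
open import Data.Product using (Σ; _×_; _,_)
open import Relation.Binary.PropositionalEquality using (_≡_; cong; module ≡-Reasoning)

-- Proposition 4.1: the matrices M with σ̃(M) = τ̃ number
-- (q-1)^b q^(b W - ℓ(τ̃) - b), i.e. a fraction (1 - q⁻¹)^b q^(-ℓ(τ̃)) of all
-- q^(b W) matrices, independently of W.
proposition4p1 : ∀ {c ℓ : Level} (R : CommutativeRing c ℓ) → IsField R →
    (q : ℕ) → HasSize R q →
    (b : ℕ) → 1 ≤ b → (τ : FlagState b) →
    (W : ℕ) → (∀ i → pos τ i < W) →
    Σ ℕ λ N →
    HasCount (Matrices._≈ᴹ_ R) (λ M → Matrices.SigmaIs R {b} {W} M τ) N ×
    N * q ^ lengthℓ τ * q ^ b ≡ (q ∸ 1) ^ b * q ^ (b * W)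
proposition4p1 R isField q hasSize b _ τ W p<W =
  (q ∸ 1) ^ b * q ^ triangle b * q ^ freeCells W (pos τ) ∅ , count-orbit τ p<W ,
  (begin
    (q ∸ 1) ^ b * q ^ triangle b * q ^ freeCells W (pos τ) ∅ * q ^ lengthℓ τ * q ^ b
      ≡⟨ collect-powers ((q ∸ 1) ^ b) q (triangle b) (freeCells W (pos τ) ∅) (lengthℓ τ) b ⟩
    (q ∸ 1) ^ b * q ^ (triangle b + freeCells W (pos τ) ∅ + lengthℓ τ + b)
      ≡⟨ cong (λ e → (q ∸ 1) ^ b * q ^ e) (exponent-identity τ W p<W) ⟩
    (q ∸ 1) ^ b * q ^ (b * W) ∎)
  where
  open ≡-Reasoning
  open PositionCounting using (triangle; freeCells; ∅; collect-powers; exponent-identity)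
  open MatrixCounting R isField q hasSize using (count-orbit)
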